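{- Let $n$ be even, let $V_0=\{v\in\{ -1,1\}^n : v_1=1,\ \sum_i v_i=0\}$ and $g(V_0)=\frac12\sum_{v\in V_0}v$. (1) If $n$ is not a power of $2$, then $g(V_0)\in P(V_0)$. (2) If $n$ is a power of $2$ and $n>2$, let $w\in\mathbb{Z}^n$ be given by $w_i=1$ if $i\not\equiv 0\pmod 4$ and $w_i=-3$ if $i\equiv 0\pmod 4$. Then $g(V_0)-\frac12 w\in P(V_0)$.
   Context: For a finite set $W\subset\mathbb{R}^n$, $P(W):=\{\sum_{w\in S} w : S\subseteq W\}$ is the set of subset sums of $W$. -}

module Defs where

open import Data.Nat using (ℕ; zero; suc; _%_)
open import Data.Bool using (Bool; true; false; _∧_)
open import Data.Integer using (ℤ; +_; -_; _+_; _*_; _-_; 1ℤ; 0ℤ)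
import Data.Integer.Properties as ℤP
open import Data.Fin using (Fin; toℕ)
open import Data.Vec using (Vec; []; _∷_; zipWith; replicate; map; tabulate; foldr)
open import Data.List using (List; filterᵇ; _++_)
import Data.List as L
open import Relation.Nullary.Decidable using (⌊_⌋)

signVecs : (n : ℕ) → List (Vec ℤ n)
signVecs zero = [] L.∷ L.[]
signVecs (suc n) = L.map (1ℤ ∷_) (signVecs n) ++ L.map ((- 1ℤ) ∷_) (signVecs n)

coordSum : ∀ {n} → Vec ℤ n → ℤ
coordSum = foldr _ _+_ 0ℤ

-- v₁ = 1 (false when n = 0, since there is no first coordinate)
firstIsOne : ∀ {n} → Vec ℤ n → Bool
firstIsOne [] = false
firstIsOne (x ∷ _) = ⌊ x ℤP.≟ 1ℤ ⌋

-- V₀ = { v ∈ {-1,1}^n : v₁ = 1, Σ_i v_i = 0 }, as a duplicate-free list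
V0 : (n : ℕ) → List (Vec ℤ n)
V0 n = filterᵇ (λ v → firstIsOne v ∧ ⌊ coordSum v ℤP.≟ 0ℤ ⌋) (signVecs n)

_+ᵥ_ : ∀ {n} → Vec ℤ n → Vec ℤ n → Vec ℤ n
_+ᵥ_ = zipWith _+_

_-ᵥ_ : ∀ {n} → Vec ℤ n → Vec ℤ n → Vec ℤ n
_-ᵥ_ = zipWith _-_

_·ᵥ_ : ∀ {n} → ℤ → Vec ℤ n → Vec ℤ n
c ·ᵥ v = map (c *_) v

vsum : ∀ {n} → List (Vec ℤ n) → Vec ℤ n
vsum {n} = L.foldr _+ᵥ_ (replicate n 0ℤ)

-- w_i = 1 if i ≢ 0 (mod 4), w_i = -3 if i ≡ 0 (mod 4), indices i = 1..n
wVec : (n : ℕ) → Vec ℤ n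
wVec n = tabulate (λ (i : Fin n) → wCoord (suc (toℕ i) % 4))
  where
  wCoord : ℕ → ℤ
  wCoord zero = - (+ 3)
  wCoord (suc _) = 1ℤ

{-# OPTIONS --safe #-}

-- V₀ consists of the vectors (1, u) with u in the layer L(n-1, -1), where L(a, s) = {u ∈ {-1,1}^a : Σ uᵢ = s}.
-- A subset S ⊆ V₀ with 2 ΣS = ΣV₀ + c is the same as a signing ε : V₀ → {±1} with Σ εᵥ v = c, so we build
-- signings of layers with prescribed signed sums. Splitting off the first coordinate,
-- L(a+1, s) = (1, L(a, s-1)) ∪ (-1, L(a, s+1)), so signings of the two parts combine. Doubling
-- u ↦ (u₁,u₁,u₂,u₂,…) embeds L(p, t) into L(2p, 2t), and the remaining vectors come in pairs (…,1,-1,x),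
-- (…,-1,1,x) that can be signed oppositely; this doubles a signing without changing its sum, except for a
-- surplus ±1 from each family of such x of odd size. By Lucas' theorem these parities are those of binomial
-- coefficients, and (2m-1 choose m) is odd exactly when m is a power of two. Hence zero-sum signings exist
-- by halving n unless n passes through 2^k or 2^k + 2; there, pins (vectors on which the paired signs agree)
-- along 4-periodic paths absorb the surplus, and for n = 2^k they leave exactly the correction w.

module Submission where

open import Defs
open import Data.Nat as ℕ using (ℕ; zero; suc; _^_; _>_; parity)
import Data.Nat.Properties as ℕP
import Data.Nat.Induction as ℕI
open import Data.Nat.Divisibility using (_∣_; divides)
open import Induction.WellFounded using (Acc; acc)
open import Data.Integer as ℤ using (ℤ; +_; -[1+_]; _+_; _-_; _*_; -_; 0ℤ; 1ℤ)
import Data.Integer.Properties as ℤP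
open import Data.Integer.Tactic.RingSolver using (solve-∀)
open import Data.Parity as ℙ using (Parity; 0ℙ; 1ℙ; _⁻¹)
import Data.Parity.Properties as ℙP
import Algebra.Properties.CommutativeSemigroup ℙP.+-commutativeSemigroup as CSP
open import Data.Bool using (Bool; true; false; not; T; _∧_)
open import Data.Bool.Properties using (T?)
open import Data.Vec as V using (Vec; []; _∷_; zipWith; replicate)
import Data.Vec.Properties as VP
open import Data.Vec.Relation.Unary.All using (All; []; _∷_)
open import Data.Vec.Relation.Binary.Pointwise.Inductive
  using (Pointwise; []; _∷_; Pointwise-≡⇒≡; zipWith-identityˡ; zipWith-identityʳ; zipWith-comm; zipWith-assoc)
open import Data.List as L using (List; []; _∷_; _++_; [_]; filterᵇ; length)
import Data.List.Properties as LP
open import Data.List.Membership.Propositional using (_∈_)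
open import Data.List.Membership.Propositional.Properties using (∈-++⁺ˡ; ∈-++⁺ʳ; ∈-map⁺; ∈-∃++)
open import Data.List.Relation.Unary.Any using (here)
open import Data.List.Relation.Binary.Sublist.Propositional using (_⊆_; []; _∷_; _∷ʳ_)
open import Data.Product using (Σ; _×_; _,_; ∃-syntax; ∃₂)
open import Data.Sum using (_⊎_; inj₁; inj₂)
open import Data.Maybe using (Maybe; just; nothing)
open import Data.Unit using (⊤; tt)
open import Data.Empty using (⊥; ⊥-elim)
open import Function using (_∘_)
open import Relation.Binary.PropositionalEquality hiding ([_])
open import Relation.Nullary using (yes; no; ¬_)
open import Relation.Nullary.Decidable using (Dec; ⌊_⌋)

0ᵥ : ∀ {n} → Vec ℤ n
0ᵥ = replicate _ 0ℤ

negᵥ : ∀ {n} → Vec ℤ n → Vec ℤ n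
negᵥ = V.map (λ z → - z)

+ᵥ-identityˡ : ∀ {n} (u : Vec ℤ n) → 0ᵥ +ᵥ u ≡ u
+ᵥ-identityˡ u = Pointwise-≡⇒≡ (zipWith-identityˡ ℤP.+-identityˡ u)

+ᵥ-identityʳ : ∀ {n} (u : Vec ℤ n) → u +ᵥ 0ᵥ ≡ u
+ᵥ-identityʳ u = Pointwise-≡⇒≡ (zipWith-identityʳ ℤP.+-identityʳ u)

+ᵥ-comm : ∀ {n} (u v : Vec ℤ n) → u +ᵥ v ≡ v +ᵥ u
+ᵥ-comm u v = Pointwise-≡⇒≡ (zipWith-comm ℤP.+-comm u v)

+ᵥ-assoc : ∀ {n} (u v w : Vec ℤ n) → (u +ᵥ v) +ᵥ w ≡ u +ᵥ (v +ᵥ w)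
+ᵥ-assoc u v w = Pointwise-≡⇒≡ (zipWith-assoc ℤP.+-assoc u v w)

negᵥ-distrib-+ᵥ : ∀ {n} (u v : Vec ℤ n) → negᵥ (u +ᵥ v) ≡ negᵥ u +ᵥ negᵥ v
negᵥ-distrib-+ᵥ [] [] = refl
negᵥ-distrib-+ᵥ (x ∷ u) (y ∷ v) = cong₂ _∷_ (ℤP.neg-distrib-+ x y) (negᵥ-distrib-+ᵥ u v)

negᵥ-0ᵥ : ∀ {n} → negᵥ (0ᵥ {n}) ≡ 0ᵥ
negᵥ-0ᵥ = VP.map-replicate _ 0ℤ _

negᵥ-involutive : ∀ {n} (u : Vec ℤ n) → negᵥ (negᵥ u) ≡ u
negᵥ-involutive [] = refl
negᵥ-involutive (x ∷ u) = cong₂ _∷_ (ℤP.neg-involutive x) (negᵥ-involutive u)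

+ᵥ-inverseʳ : ∀ {n} (u : Vec ℤ n) → u +ᵥ negᵥ u ≡ 0ᵥ
+ᵥ-inverseʳ [] = refl
+ᵥ-inverseʳ (x ∷ u) = cong₂ _∷_ (ℤP.+-inverseʳ x) (+ᵥ-inverseʳ u)

+ᵥ-leftComm : ∀ {n} (u v w : Vec ℤ n) → u +ᵥ (v +ᵥ w) ≡ v +ᵥ (u +ᵥ w)
+ᵥ-leftComm u v w = trans (sym (+ᵥ-assoc u v w)) (trans (cong (_+ᵥ w) (+ᵥ-comm u v)) (+ᵥ-assoc v u w))

·ᵥ-assoc : ∀ {n} c d (u : Vec ℤ n) → c ·ᵥ (d ·ᵥ u) ≡ (c * d) ·ᵥ u
·ᵥ-assoc c d u = trans (sym (VP.map-∘ _ _ u)) (VP.map-cong (λ z → sym (ℤP.*-assoc c d z)) u)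

·ᵥ-negˡ : ∀ {n} c (u : Vec ℤ n) → (- c) ·ᵥ u ≡ negᵥ (c ·ᵥ u)
·ᵥ-negˡ c u = trans (VP.map-cong (λ z → sym (ℤP.neg-distribˡ-* c z)) u) (VP.map-∘ _ _ u)

Vec₀-unique : {u v : Vec ℤ 0} → u ≡ v
Vec₀-unique {[]} {[]} = refl

-- Layers of the cube {-1,1}^a

IsSign : ℤ → Set
IsSign z = z ≡ 1ℤ ⊎ z ≡ - 1ℤ

layer : (a : ℕ) → ℤ → List (Vec ℤ a)
layer zero (+ zero) = [ [] ]
layer zero _ = []
layer (suc a) s = L.map (1ℤ ∷_) (layer a (s - 1ℤ)) ++ L.map (- 1ℤ ∷_) (layer a (s + 1ℤ))

∈-layer : ∀ {a} (u : Vec ℤ a) → All IsSign u → u ∈ layer a (coordSum u)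
∈-layer [] [] = here refl
∈-layer (x ∷ u) (inj₁ refl ∷ signs) =
  ∈-++⁺ˡ (∈-map⁺ (1ℤ ∷_) (subst (λ s → u ∈ layer _ s) (shift (coordSum u)) (∈-layer u signs)))
  where shift : ∀ c → c ≡ (1ℤ + c) - 1ℤ
        shift = solve-∀
∈-layer (x ∷ u) (inj₂ refl ∷ signs) =
  ∈-++⁺ʳ _ (∈-map⁺ (- 1ℤ ∷_) (subst (λ s → u ∈ layer _ s) (shift (coordSum u)) (∈-layer u signs)))
  where shift : ∀ c → c ≡ (- 1ℤ + c) + 1ℤ
        shift = solve-∀

filterᵇ-map : ∀ {A B : Set} (p : B → Bool) (f : A → B) (xs : List A) →
              filterᵇ p (L.map f xs) ≡ L.map f (filterᵇ (p ∘ f) xs)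
filterᵇ-map p f [] = refl
filterᵇ-map p f (x ∷ xs) with p (f x)
... | true  = cong (f x ∷_) (filterᵇ-map p f xs)
... | false = filterᵇ-map p f xs

filterᵇ-cong : ∀ {A : Set} {p q : A → Bool} → (∀ x → p x ≡ q x) → ∀ xs → filterᵇ p xs ≡ filterᵇ q xs
filterᵇ-cong {p = p} {q} p≗q =
  LP.filter-≐ (T? ∘ p) (T? ∘ q) ((λ {x} → subst T (p≗q x)) , (λ {x} → subst T (sym (p≗q x))))

filterᵇ-false : ∀ {A : Set} (xs : List A) → filterᵇ (λ _ → false) xs ≡ []
filterᵇ-false [] = refl
filterᵇ-false (x ∷ xs) = filterᵇ-false xs

⌊⌋-cong : ∀ {A B : Set} (a? : Dec A) (b? : Dec B) → (A → B) → (B → A) → ⌊ a? ⌋ ≡ ⌊ b? ⌋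
⌊⌋-cong (yes _) (yes _) _ _ = refl
⌊⌋-cong (no _)  (no _)  _ _ = refl
⌊⌋-cong (yes a) (no ¬b) f _ = ⊥-elim (¬b (f a))
⌊⌋-cong (no ¬a) (yes b) _ g = ⊥-elim (¬a (g b))

does-shift : ∀ c x s → ⌊ c + x ℤP.≟ s ⌋ ≡ ⌊ x ℤP.≟ s - c ⌋
does-shift c x s = ⌊⌋-cong (c + x ℤP.≟ s) (x ℤP.≟ s - c)
  (λ c+x≡s → trans (cancelˡ c x) (cong (_- c) c+x≡s))
  (λ x≡s-c → trans (cong (λ y → c + y) x≡s-c) (cancelʳ c s))
  where cancelˡ : ∀ c x → x ≡ (c + x) - c
        cancelˡ = solve-∀
        cancelʳ : ∀ c s → c + (s - c) ≡ s
        cancelʳ = solve-∀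

filterᵇ-signVecs : ∀ {a} (P : Vec ℤ (suc a) → Bool) →
  filterᵇ P (signVecs (suc a))
    ≡ L.map (1ℤ ∷_) (filterᵇ (P ∘ (1ℤ ∷_)) (signVecs a)) ++ L.map (- 1ℤ ∷_) (filterᵇ (P ∘ (- 1ℤ ∷_)) (signVecs a))
filterᵇ-signVecs {a} P = trans (LP.filter-++ (T? ∘ P) (L.map (1ℤ ∷_) (signVecs a)) _)
  (cong₂ _++_ (filterᵇ-map P (1ℤ ∷_) (signVecs a)) (filterᵇ-map P (- 1ℤ ∷_) (signVecs a)))

filter-signVecs : ∀ a s → filterᵇ (λ v → ⌊ coordSum v ℤP.≟ s ⌋) (signVecs a) ≡ layer a s
filter-signVecs zero (+ zero) = refl
filter-signVecs zero (+ suc n) = refl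
filter-signVecs zero -[1+ n ] = refl
filter-signVecs (suc a) s = trans (filterᵇ-signVecs (λ v → ⌊ coordSum v ℤP.≟ s ⌋))
  (cong₂ (λ xs ys → L.map (1ℤ ∷_) xs ++ L.map (- 1ℤ ∷_) ys)
         (trans (filterᵇ-cong (λ v → does-shift 1ℤ (coordSum v) s) (signVecs a)) (filter-signVecs a (s - 1ℤ)))
         (trans (filterᵇ-cong (λ v → does-shift (- 1ℤ) (coordSum v) s) (signVecs a)) (filter-signVecs a (s + 1ℤ))))

V0-layer : ∀ a → V0 (suc a) ≡ L.map (1ℤ ∷_) (layer a (- 1ℤ))
V0-layer a = begin
  V0 (suc a)
    ≡⟨ filterᵇ-signVecs (λ v → firstIsOne v ∧ ⌊ coordSum v ℤP.≟ 0ℤ ⌋) ⟩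
  L.map (1ℤ ∷_) (filterᵇ (λ v → ⌊ 1ℤ + coordSum v ℤP.≟ 0ℤ ⌋) (signVecs a))
    ++ L.map (- 1ℤ ∷_) (filterᵇ (λ _ → false) (signVecs a))
    ≡⟨ cong₂ (λ xs ys → L.map (1ℤ ∷_) xs ++ L.map (- 1ℤ ∷_) ys)
             (trans (filterᵇ-cong (λ v → does-shift 1ℤ (coordSum v) 0ℤ) (signVecs a)) (filter-signVecs a (- 1ℤ)))
             (filterᵇ-false (signVecs a)) ⟩
  L.map (1ℤ ∷_) (layer a (- 1ℤ)) ++ []
    ≡⟨ LP.++-identityʳ _ ⟩
  L.map (1ℤ ∷_) (layer a (- 1ℤ)) ∎
  where open ≡-Reasoning

-- Signings

infixr 5 _∷_

data Signing {A : Set} : List A → Set where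
  []  : Signing []
  _∷_ : ∀ {x xs} → Bool → Signing xs → Signing (x ∷ xs)

sgn : Bool → ℤ
sgn true  = 1ℤ
sgn false = - 1ℤ

sgn-not : ∀ b → sgn (not b) ≡ - sgn b
sgn-not true  = refl
sgn-not false = refl

total : ∀ {A : Set} {xs : List A} → Signing xs → ℤ
total [] = 0ℤ
total (b ∷ ε) = sgn b + total ε

signedSum : ∀ {a} {xs : List (Vec ℤ a)} → Signing xs → Vec ℤ a
signedSum [] = 0ᵥ
signedSum {xs = x ∷ _} (b ∷ ε) = (sgn b ·ᵥ x) +ᵥ signedSum ε

module _ {A : Set} where

  _++ˢ_ : {xs ys : List A} → Signing xs → Signing ys → Signing (xs ++ ys)
  [] ++ˢ η = η
  (b ∷ ε) ++ˢ η = b ∷ (ε ++ˢ η)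

  split-++ˢ : (xs : List A) {ys : List A} (ε : Signing (xs ++ ys)) →
              Σ (Signing xs) λ ε₁ → Σ (Signing ys) λ ε₂ → ε₁ ++ˢ ε₂ ≡ ε
  split-++ˢ [] ε = [] , ε , refl
  split-++ˢ (x ∷ xs) (b ∷ ε) with split-++ˢ xs ε
  ... | ε₁ , ε₂ , refl = b ∷ ε₁ , ε₂ , refl

  total-++ˢ : {xs ys : List A} (ε : Signing xs) (η : Signing ys) → total (ε ++ˢ η) ≡ total ε + total η
  total-++ˢ [] η = sym (ℤP.+-identityˡ _)
  total-++ˢ (b ∷ ε) η = trans (cong (λ t → sgn b + t) (total-++ˢ ε η)) (sym (ℤP.+-assoc (sgn b) _ _))

  negˢ : {xs : List A} → Signing xs → Signing xs
  negˢ [] = []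
  negˢ (b ∷ ε) = not b ∷ negˢ ε

  total-negˢ : {xs : List A} (ε : Signing xs) → total (negˢ ε) ≡ - total ε
  total-negˢ [] = refl
  total-negˢ (b ∷ ε) = trans (cong₂ _+_ (sgn-not b) (total-negˢ ε)) (sym (ℤP.neg-distrib-+ (sgn b) _))

module _ {A B : Set} {f : A → B} where

  mapˢ : {xs : List A} → Signing xs → Signing (L.map f xs)
  mapˢ [] = []
  mapˢ (b ∷ ε) = b ∷ mapˢ ε

  unmapˢ : (xs : List A) → Signing (L.map f xs) → Signing xs
  unmapˢ [] [] = []
  unmapˢ (x ∷ xs) (b ∷ ε) = b ∷ unmapˢ xs ε

  mapˢ-unmapˢ : (xs : List A) (ε : Signing (L.map f xs)) → mapˢ (unmapˢ xs ε) ≡ ε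
  mapˢ-unmapˢ [] [] = refl
  mapˢ-unmapˢ (x ∷ xs) (b ∷ ε) = cong (b ∷_) (mapˢ-unmapˢ xs ε)

  total-mapˢ : {xs : List A} (ε : Signing xs) → total (mapˢ ε) ≡ total ε
  total-mapˢ [] = refl
  total-mapˢ (b ∷ ε) = cong (λ t → sgn b + t) (total-mapˢ ε)

module _ {a : ℕ} where

  signedSum-++ˢ : {xs ys : List (Vec ℤ a)} (ε : Signing xs) (η : Signing ys) →
                  signedSum (ε ++ˢ η) ≡ signedSum ε +ᵥ signedSum η
  signedSum-++ˢ [] η = sym (+ᵥ-identityˡ _)
  signedSum-++ˢ {x ∷ _} (b ∷ ε) η =
    trans (cong ((sgn b ·ᵥ x) +ᵥ_) (signedSum-++ˢ ε η)) (sym (+ᵥ-assoc _ _ _))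

  signedSum-negˢ : {xs : List (Vec ℤ a)} (ε : Signing xs) → signedSum (negˢ ε) ≡ negᵥ (signedSum ε)
  signedSum-negˢ [] = sym negᵥ-0ᵥ
  signedSum-negˢ {x ∷ _} (b ∷ ε) = begin
    (sgn (not b) ·ᵥ x) +ᵥ signedSum (negˢ ε)
      ≡⟨ cong₂ _+ᵥ_ (trans (cong (_·ᵥ x) (sgn-not b)) (·ᵥ-negˡ (sgn b) x)) (signedSum-negˢ ε) ⟩
    negᵥ (sgn b ·ᵥ x) +ᵥ negᵥ (signedSum ε)
      ≡⟨ negᵥ-distrib-+ᵥ _ _ ⟨
    negᵥ ((sgn b ·ᵥ x) +ᵥ signedSum ε) ∎
    where open ≡-Reasoning

  signedSum-mapˢ-∷ : ∀ c {xs : List (Vec ℤ a)} (ε : Signing xs) →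
                     signedSum (mapˢ {f = c ∷_} ε) ≡ (c * total ε) ∷ signedSum ε
  signedSum-mapˢ-∷ c [] = cong (_∷ 0ᵥ) (sym (ℤP.*-zeroʳ c))
  signedSum-mapˢ-∷ c {x ∷ _} (b ∷ ε) rewrite signedSum-mapˢ-∷ c ε =
    cong (_∷ ((sgn b ·ᵥ x) +ᵥ signedSum ε)) (distrib (sgn b) c (total ε))
    where distrib : ∀ e c t → e * c + c * t ≡ c * (e + t)
          distrib = solve-∀

module _ {a : ℕ} {s : ℤ} where

  consˢ : Signing (layer a (s - 1ℤ)) → Signing (layer a (s + 1ℤ)) → Signing (layer (suc a) s)
  consˢ ε₁ ε₂ = mapˢ ε₁ ++ˢ mapˢ ε₂

  total-consˢ : ∀ ε₁ ε₂ → total (consˢ ε₁ ε₂) ≡ total ε₁ + total ε₂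
  total-consˢ ε₁ ε₂ =
    trans (total-++ˢ (mapˢ ε₁) (mapˢ ε₂)) (cong₂ _+_ (total-mapˢ ε₁) (total-mapˢ ε₂))

  signedSum-consˢ : ∀ ε₁ ε₂ →
    signedSum (consˢ ε₁ ε₂) ≡ (total ε₁ - total ε₂) ∷ (signedSum ε₁ +ᵥ signedSum ε₂)
  signedSum-consˢ ε₁ ε₂
    rewrite signedSum-++ˢ (mapˢ {f = 1ℤ ∷_} ε₁) (mapˢ {f = - 1ℤ ∷_} ε₂)
          | signedSum-mapˢ-∷ 1ℤ ε₁ | signedSum-mapˢ-∷ (- 1ℤ) ε₂ =
    cong (_∷ (signedSum ε₁ +ᵥ signedSum ε₂)) (signs (total ε₁) (total ε₂))
    where signs : ∀ x y → 1ℤ * x + - 1ℤ * y ≡ x - y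
          signs = solve-∀

  unconsˢ : (ε : Signing (layer (suc a) s)) →
            Σ (Signing (layer a (s - 1ℤ))) λ ε₁ → Σ (Signing (layer a (s + 1ℤ))) λ ε₂ →
            consˢ ε₁ ε₂ ≡ ε
  unconsˢ ε with split-++ˢ (L.map (1ℤ ∷_) (layer a (s - 1ℤ))) ε
  ... | η₁ , η₂ , refl =
    unmapˢ _ η₁ , unmapˢ _ η₂ , cong₂ _++ˢ_ (mapˢ-unmapˢ _ η₁) (mapˢ-unmapˢ _ η₂)

record Signable (a : ℕ) (s σ : ℤ) (F : Vec ℤ a) : Set where
  constructor signable
  field
    signing           : Signing (layer a s)
    total-signing     : total signing ≡ σ
    signedSum-signing : signedSum signing ≡ F

cons : ∀ {a s σ₁ σ₂ F₁ F₂} → Signable a (s - 1ℤ) σ₁ F₁ → Signable a (s + 1ℤ) σ₂ F₂ →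
       Signable (suc a) s (σ₁ + σ₂) ((σ₁ - σ₂) ∷ (F₁ +ᵥ F₂))
cons {a} {s} (signable ε₁ refl refl) (signable ε₂ refl refl) =
  signable (consˢ {a} {s} ε₁ ε₂) (total-consˢ {a} {s} ε₁ ε₂) (signedSum-consˢ {a} {s} ε₁ ε₂)

cons₂ : ∀ {a s σ₁ x y σ₂ F₁ X Y F₂} →
  Signable a (s - 1ℤ - 1ℤ) σ₁ F₁ → Signable a s x X → Signable a s y Y →
  Signable a (s + 1ℤ + 1ℤ) σ₂ F₂ →
  Signable (suc (suc a)) s ((σ₁ + x) + (y + σ₂))
           (((σ₁ + x) - (y + σ₂)) ∷ ((σ₁ - x) + (y - σ₂)) ∷ ((F₁ +ᵥ X) +ᵥ (Y +ᵥ F₂)))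
cons₂ {a} {s} {x = x} {y} {X = X} {Y} lower middle₁ middle₂ upper =
  cons {s = s} (cons {s = s - 1ℤ} lower (subst (λ s′ → Signable a s′ x X) (back s) middle₁))
               (cons {s = s + 1ℤ} (subst (λ s′ → Signable a s′ y Y) (forth s) middle₂) upper)
  where back : ∀ s → s ≡ s - 1ℤ + 1ℤ
        back = solve-∀
        forth : ∀ s → s ≡ s + 1ℤ - 1ℤ
        forth = solve-∀

signable-[] : ∀ a s → layer a s ≡ [] → Signable a s 0ℤ 0ᵥ
signable-[] a s empty = signable (subst Signing (sym empty) []) (total-subst (sym empty)) (signedSum-subst (sym empty))
  where
  total-subst : ∀ {xs} (eq : [] ≡ xs) → total (subst Signing eq []) ≡ 0ℤ
  total-subst refl = refl
  signedSum-subst : ∀ {xs} (eq : [] ≡ xs) → signedSum (subst Signing eq []) ≡ 0ᵥ {a}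
  signedSum-subst refl = refl

negate : ∀ {a s σ F} → Signable a s σ F → Signable a s (- σ) (negᵥ F)
negate (signable ε refl refl) = signable (negˢ ε) (total-negˢ ε) (signedSum-negˢ ε)

-- u ↦ -u maps layer a s onto layer a (-s)
reflect : ∀ {a s σ F} → Signable a s σ F → Signable a (- s) σ (negᵥ F)
reflect {zero} {+ zero}    (signable ε σ≡ _) = signable ε σ≡ Vec₀-unique
reflect {zero} {+ suc _}   (signable ε σ≡ _) = signable ε σ≡ Vec₀-unique
reflect {zero} { -[1+ _ ]} (signable ε σ≡ _) = signable ε σ≡ Vec₀-unique
reflect {suc a} {s} (signable ε refl refl) with unconsˢ {a} {s} ε
... | ε₁ , ε₂ , refl = subst₂ (Signable (suc a) (- s)) totals sums (cons {a} { - s} reflect₂ reflect₁)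
  where
  neg₊ : ∀ s → - (s + 1ℤ) ≡ - s - 1ℤ
  neg₊ = solve-∀
  neg₋ : ∀ s → - (s - 1ℤ) ≡ - s + 1ℤ
  neg₋ = solve-∀
  swap : ∀ x y → y - x ≡ - (x - y)
  swap = solve-∀
  reflect₂ : Signable a (- s - 1ℤ) (total ε₂) (negᵥ (signedSum ε₂))
  reflect₂ = subst (λ t → Signable a t (total ε₂) (negᵥ (signedSum ε₂))) (neg₊ s)
                   (reflect (signable ε₂ refl refl))
  reflect₁ : Signable a (- s + 1ℤ) (total ε₁) (negᵥ (signedSum ε₁))
  reflect₁ = subst (λ t → Signable a t (total ε₁) (negᵥ (signedSum ε₁))) (neg₋ s)
                   (reflect (signable ε₁ refl refl))
  totals : total ε₂ + total ε₁ ≡ total (consˢ {a} {s} ε₁ ε₂)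
  totals = trans (ℤP.+-comm (total ε₂) (total ε₁)) (sym (total-consˢ {a} {s} ε₁ ε₂))
  sums : (total ε₂ - total ε₁) ∷ (negᵥ (signedSum ε₂) +ᵥ negᵥ (signedSum ε₁))
         ≡ negᵥ (signedSum (consˢ {a} {s} ε₁ ε₂))
  sums = trans (cong₂ _∷_ (swap (total ε₁) (total ε₂))
                          (trans (+ᵥ-comm _ _) (sym (negᵥ-distrib-+ᵥ (signedSum ε₁) (signedSum ε₂)))))
               (cong negᵥ (sym (signedSum-consˢ {a} {s} ε₁ ε₂)))

positives : ∀ {A : Set} {xs : List A} → Signing xs → List A
positives [] = []
positives {xs = x ∷ _} (true ∷ ε) = x ∷ positives ε
positives (false ∷ ε) = positives ε

positives-⊆ : ∀ {A : Set} {xs : List A} (ε : Signing xs) → positives ε ⊆ xs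
positives-⊆ [] = []
positives-⊆ (true ∷ ε) = refl ∷ positives-⊆ ε
positives-⊆ {xs = x ∷ _} (false ∷ ε) = x ∷ʳ positives-⊆ ε

vsum-positives : ∀ {a} {xs : List (Vec ℤ a)} (ε : Signing xs) →
                 (+ 2) ·ᵥ vsum (positives ε) ≡ vsum xs +ᵥ signedSum ε
vsum-positives [] = trans (VP.map-replicate _ 0ℤ _) (sym (+ᵥ-identityˡ 0ᵥ))
vsum-positives {xs = x ∷ xs} (true ∷ ε) = keep x (vsum (positives ε)) (vsum xs) (signedSum ε) (vsum-positives ε)
  where
  keep : ∀ {n} (x P V S : Vec ℤ n) → (+ 2) ·ᵥ P ≡ V +ᵥ S →
         (+ 2) ·ᵥ (x +ᵥ P) ≡ (x +ᵥ V) +ᵥ ((1ℤ ·ᵥ x) +ᵥ S)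
  keep [] [] [] [] _ = refl
  keep (x ∷ xs) (p ∷ ps) (v ∷ vs) (s ∷ ss) eq =
    cong₂ _∷_ (trans (ℤP.*-distribˡ-+ (+ 2) x p)
                      (trans (cong (λ z → + 2 * x + z) (VP.∷-injectiveˡ eq)) (identity x v s)))
              (keep xs ps vs ss (VP.∷-injectiveʳ eq))
    where identity : ∀ x v s → + 2 * x + (v + s) ≡ (x + v) + (1ℤ * x + s)
          identity = solve-∀
vsum-positives {xs = x ∷ xs} (false ∷ ε) = skip x (vsum (positives ε)) (vsum xs) (signedSum ε) (vsum-positives ε)
  where
  skip : ∀ {n} (x P V S : Vec ℤ n) → (+ 2) ·ᵥ P ≡ V +ᵥ S →
         (+ 2) ·ᵥ P ≡ (x +ᵥ V) +ᵥ (((- 1ℤ) ·ᵥ x) +ᵥ S)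
  skip [] [] [] [] _ = refl
  skip (x ∷ xs) (p ∷ ps) (v ∷ vs) (s ∷ ss) eq =
    cong₂ _∷_ (trans (VP.∷-injectiveˡ eq) (identity x v s)) (skip xs ps vs ss (VP.∷-injectiveʳ eq))
    where identity : ∀ x v s → v + s ≡ (x + v) + (- 1ℤ * x + s)
          identity = solve-∀

subset-of-signing : ∀ {a σ F} → Signable a (- 1ℤ) σ F →
  ∃[ S ] (S ⊆ V0 (suc a) × (+ 2) ·ᵥ vsum S ≡ vsum (V0 (suc a)) +ᵥ (σ ∷ F))
subset-of-signing {a} (signable ε refl refl) rewrite V0-layer a =
  positives (mapˢ ε) , positives-⊆ (mapˢ ε) ,
  trans (vsum-positives (mapˢ ε))
        (cong (vsum (L.map (1ℤ ∷_) (layer a (- 1ℤ))) +ᵥ_)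
              (trans (signedSum-mapˢ-∷ 1ℤ ε) (cong (_∷ signedSum ε) (ℤP.*-identityˡ (total ε)))))

-- Parity of layer sizes

twice : ℕ → ℕ
twice zero = zero
twice (suc n) = suc (suc (twice n))

twice-≡-2* : ∀ n → twice n ≡ 2 ℕ.* n
twice-≡-2* zero = refl
twice-≡-2* (suc n) = trans (cong (suc ∘ suc) (twice-≡-2* n)) (sym (ℕP.+-suc (suc n) (n ℕ.+ 0)))

parity-twice : ∀ n → parity (twice n) ≡ 0ℙ
parity-twice zero = refl
parity-twice (suc n) = parity-twice n

parity-suc-twice : ∀ n → parity (suc (twice n)) ≡ 1ℙ
parity-suc-twice zero = refl
parity-suc-twice (suc n) = parity-suc-twice n

layerParity : ℕ → ℤ → Parity
layerParity a s = parity (length (layer a s))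

layerParity-suc : ∀ a s → layerParity (suc a) s ≡ layerParity a (s - 1ℤ) ℙ.+ layerParity a (s + 1ℤ)
layerParity-suc a s = begin
  parity (length (L.map (1ℤ ∷_) L₁ ++ L.map (- 1ℤ ∷_) L₂))
    ≡⟨ cong parity (LP.length-++ (L.map (1ℤ ∷_) L₁)) ⟩
  parity (length (L.map (1ℤ ∷_) L₁) ℕ.+ length (L.map (- 1ℤ ∷_) L₂))
    ≡⟨ ℙP.+-homo-+ (length (L.map (1ℤ ∷_) L₁)) (length (L.map (- 1ℤ ∷_) L₂)) ⟩
  parity (length (L.map (1ℤ ∷_) L₁)) ℙ.+ parity (length (L.map (- 1ℤ ∷_) L₂))
    ≡⟨ cong₂ (λ m n → parity m ℙ.+ parity n) (LP.length-map _ L₁) (LP.length-map _ L₂) ⟩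
  parity (length L₁) ℙ.+ parity (length L₂) ∎
  where
  open ≡-Reasoning
  L₁ : List (Vec ℤ a)
  L₁ = layer a (s - 1ℤ)
  L₂ : List (Vec ℤ a)
  L₂ = layer a (s + 1ℤ)

parityℤ : ℤ → Parity
parityℤ s = parity ℤ.∣ s ∣

parityℤ-pred : ∀ s → parityℤ (s - 1ℤ) ≡ parityℤ s ⁻¹
parityℤ-pred (+ zero)   = refl
parityℤ-pred (+ suc n)  = sym (ℙP.suc-homo-⁻¹ n)
parityℤ-pred -[1+ n ]   = trans (cong parity (ℕP.+-identityʳ n)) (sym (ℙP.suc-homo-⁻¹ n))

parityℤ-suc : ∀ s → parityℤ (s + 1ℤ) ≡ parityℤ s ⁻¹
parityℤ-suc (+ n) = trans (cong parity (ℕP.+-comm n 1)) (sym (ℙP.⁻¹-selfInverse (ℙP.suc-homo-⁻¹ n)))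
parityℤ-suc -[1+ zero ]  = refl
parityℤ-suc -[1+ suc n ] = sym (ℙP.suc-homo-⁻¹ (suc n))

layer-[] : ∀ a s → parity a ≡ parityℤ s ⁻¹ → layer a s ≡ []
layer-[] zero (+ zero) ()
layer-[] zero (+ suc n) _ = refl
layer-[] zero -[1+ n ]  _ = refl
layer-[] (suc a) s a≢s = cong₂ _++_
  (cong (L.map (1ℤ ∷_)) (layer-[] a (s - 1ℤ) (step {s - 1ℤ} (parityℤ-pred s))))
  (cong (L.map (- 1ℤ ∷_)) (layer-[] a (s + 1ℤ) (step {s + 1ℤ} (parityℤ-suc s))))
  where
  step : ∀ {s′} → parityℤ s′ ≡ parityℤ s ⁻¹ → parity a ≡ parityℤ s′ ⁻¹
  step {s′} eq = begin
    parity a               ≡⟨ ℙP.suc-homo-⁻¹ a ⟨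
    parity (suc a) ⁻¹      ≡⟨ cong _⁻¹ a≢s ⟩
    parityℤ s ⁻¹ ⁻¹        ≡⟨ cong _⁻¹ eq ⟨
    parityℤ s′ ⁻¹          ∎
    where open ≡-Reasoning

layer-empty-odd-sum : ∀ q → layer (twice q) (- 1ℤ) ≡ []
layer-empty-odd-sum q = layer-[] (twice q) (- 1ℤ) (parity-twice q)

layer-empty-odd-dim : ∀ q → layer (suc (twice q)) 0ℤ ≡ []
layer-empty-odd-dim q = layer-[] (suc (twice q)) 0ℤ (parity-suc-twice q)

layerParity-[] : ∀ a s → layer a s ≡ [] → layerParity a s ≡ 0ℙ
layerParity-[] _ _ empty = cong (parity ∘ length) empty

+-cancel-middle : ∀ x y z → (x ℙ.+ y) ℙ.+ (y ℙ.+ z) ≡ x ℙ.+ z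
+-cancel-middle 0ℙ 0ℙ z = refl
+-cancel-middle 0ℙ 1ℙ z = ℙP.⁻¹-involutive z
+-cancel-middle 1ℙ 0ℙ z = refl
+-cancel-middle 1ℙ 1ℙ z = refl

-- a case of Lucas' theorem: (2a choose a+t) ≡ (a choose (a+t)/2) (mod 2)
lucas : ∀ a t → layerParity (twice a) (t + t) ≡ layerParity a t
lucas zero (+ zero)  = refl
lucas zero (+ suc n) = refl
lucas zero -[1+ n ]  = refl
lucas (suc a) t = begin
  layerParity (suc (suc (twice a))) (t + t)
    ≡⟨ layerParity-suc (suc (twice a)) (t + t) ⟩
  layerParity (suc (twice a)) (t + t - 1ℤ) ℙ.+ layerParity (suc (twice a)) (t + t + 1ℤ)
    ≡⟨ cong₂ ℙ._+_ (layerParity-suc (twice a) (t + t - 1ℤ)) (layerParity-suc (twice a) (t + t + 1ℤ)) ⟩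
  (P (t + t - 1ℤ - 1ℤ) ℙ.+ P (t + t - 1ℤ + 1ℤ)) ℙ.+ (P (t + t + 1ℤ - 1ℤ) ℙ.+ P (t + t + 1ℤ + 1ℤ))
    ≡⟨ cong₂ (λ x y → (P (t + t - 1ℤ - 1ℤ) ℙ.+ P x) ℙ.+ (P y ℙ.+ P (t + t + 1ℤ + 1ℤ)))
             (back t) (forth t) ⟩
  (P (t + t - 1ℤ - 1ℤ) ℙ.+ P (t + t)) ℙ.+ (P (t + t) ℙ.+ P (t + t + 1ℤ + 1ℤ))
    ≡⟨ +-cancel-middle (P (t + t - 1ℤ - 1ℤ)) (P (t + t)) (P (t + t + 1ℤ + 1ℤ)) ⟩
  P (t + t - 1ℤ - 1ℤ) ℙ.+ P (t + t + 1ℤ + 1ℤ)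
    ≡⟨ cong₂ ℙ._+_ (trans (cong P (down t)) (lucas a (t - 1ℤ))) (trans (cong P (up t)) (lucas a (t + 1ℤ))) ⟩
  layerParity a (t - 1ℤ) ℙ.+ layerParity a (t + 1ℤ)
    ≡⟨ layerParity-suc a t ⟨
  layerParity (suc a) t ∎
  where
  open ≡-Reasoning
  P : ℤ → Parity
  P = layerParity (twice a)
  back : ∀ t → t + t - 1ℤ + 1ℤ ≡ t + t
  back = solve-∀
  forth : ∀ t → t + t + 1ℤ - 1ℤ ≡ t + t
  forth = solve-∀
  down : ∀ t → t + t - 1ℤ - 1ℤ ≡ (t - 1ℤ) + (t - 1ℤ)
  down = solve-∀
  up : ∀ t → t + t + 1ℤ + 1ℤ ≡ (t + 1ℤ) + (t + 1ℤ)
  up = solve-∀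

-- predDyadic k r = 2^k (2r + 1) - 1
predDyadic : ℕ → ℕ → ℕ
predDyadic zero r = twice r
predDyadic (suc k) r = suc (twice (predDyadic k r))

data EvenOdd : ℕ → Set where
  even : ∀ r → EvenOdd (twice r)
  odd  : ∀ r → EvenOdd (suc (twice r))

evenOdd : ∀ n → EvenOdd n
evenOdd zero = even zero
evenOdd (suc n) with evenOdd n
... | even r = odd r
... | odd r  = even (suc r)

n≤twice : ∀ n → n ℕ.≤ twice n
n≤twice zero = ℕ.z≤n
n≤twice (suc n) = ℕ.s≤s (ℕP.m≤n⇒m≤1+n (n≤twice n))

predDyadic-surjective : ∀ q → ∃₂ λ k r → q ≡ predDyadic k r
predDyadic-surjective q = go q (ℕI.<-wellFounded q)
  where
  go : ∀ q → Acc ℕ._<_ q → ∃₂ λ k r → q ≡ predDyadic k r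
  go q (acc smaller) with evenOdd q
  ... | even r = 0 , r , refl
  ... | odd q′ with go q′ (smaller (ℕ.s≤s (n≤twice q′)))
  ...   | k , r , refl = suc k , r , refl

suc-predDyadic-0 : ∀ k → suc (predDyadic k 0) ≡ 2 ^ k
suc-predDyadic-0 zero = refl
suc-predDyadic-0 (suc k) = trans (twice-≡-2* (suc (predDyadic k 0))) (cong (2 ℕ.*_) (suc-predDyadic-0 k))

suc-predDyadic-pow2 : ∀ k r j → suc (predDyadic k r) ≡ 2 ^ j → r ≡ 0
suc-predDyadic-pow2 zero zero j _ = refl
suc-predDyadic-pow2 zero (suc r) zero ()
suc-predDyadic-pow2 zero (suc r) (suc j) odd≡even
  with trans (sym (parity-suc-twice (suc r))) (trans (cong parity odd≡even) (ℙP.*-homo-* 2 (2 ^ j)))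
... | ()
suc-predDyadic-pow2 (suc k) r zero ()
suc-predDyadic-pow2 (suc k) r (suc j) eq =
  suc-predDyadic-pow2 k r j (ℕP.*-cancelˡ-≡ _ _ 2 (trans (sym (twice-≡-2* (suc (predDyadic k r)))) eq))

layerParity-0 : ∀ m → layerParity (suc m) 0ℤ ≡ 0ℙ
layerParity-0 m with predDyadic-surjective m
... | k , r , refl = central k r
  where
  central : ∀ k r → layerParity (suc (predDyadic k r)) 0ℤ ≡ 0ℙ
  central zero r = layerParity-[] _ 0ℤ (layer-empty-odd-dim r)
  central (suc k) r = trans (lucas (suc (predDyadic k r)) 0ℤ) (central k r)

layerParity-halve : ∀ q → layerParity (suc (twice (suc (twice q)))) (- 1ℤ) ≡ layerParity (suc (twice q)) (- 1ℤ)
layerParity-halve q = begin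
  layerParity (suc (twice q′)) (- 1ℤ)
    ≡⟨ layerParity-suc (twice q′) (- 1ℤ) ⟩
  layerParity (twice q′) (- 1ℤ - 1ℤ) ℙ.+ layerParity (twice q′) 0ℤ
    ≡⟨ cong₂ ℙ._+_ (lucas q′ (- 1ℤ)) (lucas q′ 0ℤ) ⟩
  layerParity q′ (- 1ℤ) ℙ.+ layerParity q′ 0ℤ
    ≡⟨ cong (layerParity q′ (- 1ℤ) ℙ.+_) (layerParity-[] _ 0ℤ (layer-empty-odd-dim q)) ⟩
  layerParity q′ (- 1ℤ) ℙ.+ 0ℙ
    ≡⟨ ℙP.+-identityʳ _ ⟩
  layerParity q′ (- 1ℤ) ∎
  where
  open ≡-Reasoning
  q′ : ℕ
  q′ = suc (twice q)

-- |layer (2m - 1) (-1)| = (2m-1 choose m) is odd exactly when m is a power of two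
layerParity-pow2 : ∀ k → layerParity (suc (twice (predDyadic k 0))) (- 1ℤ) ≡ 1ℙ
layerParity-pow2 zero = refl
layerParity-pow2 (suc k) = trans (layerParity-halve (predDyadic k 0)) (layerParity-pow2 k)

layerParity-not-pow2 : ∀ k r → layerParity (suc (twice (predDyadic k (suc r)))) (- 1ℤ) ≡ 0ℙ
layerParity-not-pow2 zero r = begin
  layerParity (suc (twice q)) (- 1ℤ)
    ≡⟨ layerParity-suc (twice q) (- 1ℤ) ⟩
  layerParity (twice q) (- 1ℤ - 1ℤ) ℙ.+ layerParity (twice q) 0ℤ
    ≡⟨ cong₂ ℙ._+_ (lucas (twice (suc r)) (- 1ℤ)) (lucas (twice (suc r)) 0ℤ) ⟩
  layerParity (twice (suc r)) (- 1ℤ) ℙ.+ layerParity (twice (suc r)) 0ℤ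
    ≡⟨ cong₂ ℙ._+_ (layerParity-[] _ (- 1ℤ) (layer-empty-odd-sum (suc r))) (layerParity-0 (suc (twice r))) ⟩
  0ℙ ∎
  where
  open ≡-Reasoning
  q : ℕ
  q = twice (suc r)
layerParity-not-pow2 (suc k) r = trans (layerParity-halve (predDyadic k (suc r))) (layerParity-not-pow2 k r)

-- the totals a signing of a list of the given length parity can be brought down to
MinTotal : Parity → ℤ → Set
MinTotal 0ℙ τ = τ ≡ 0ℤ
MinTotal 1ℙ τ = IsSign τ

signing-with-total : ∀ {A : Set} (xs : List A) {τ} → MinTotal (parity (length xs)) τ →
                     Σ (Signing xs) λ ε → total ε ≡ τ
signing-with-total [] refl = [] , refl
signing-with-total (_ ∷ []) (inj₁ refl) = true ∷ [] , refl
signing-with-total (_ ∷ []) (inj₂ refl) = false ∷ [] , refl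
signing-with-total (_ ∷ _ ∷ xs) τ-ok with signing-with-total xs τ-ok
... | ε , refl = true ∷ false ∷ ε , cancel (total ε)
  where cancel : ∀ t → 1ℤ + (- 1ℤ + t) ≡ t
        cancel = solve-∀

-- g signs the block (1,-1,x) and g′ the block (-1,1,x), x ∈ xs; together they add σ to the total,
-- (2τ, -2τ) to the first two coordinates and V to the others
MiddlePair : ∀ {a} → List (Vec ℤ a) → ℤ → ℤ → Vec ℤ a → Set
MiddlePair xs σ τ V = Σ (Signing xs) λ g → Σ (Signing xs) λ g′ →
  total g + total g′ ≡ σ × total g - total g′ ≡ + 2 * τ × signedSum g +ᵥ signedSum g′ ≡ V

opposite-pair : ∀ {a} (xs : List (Vec ℤ a)) {τ} → MinTotal (parity (length xs)) τ → MiddlePair xs 0ℤ τ 0ᵥ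
opposite-pair xs τ-ok with signing-with-total xs τ-ok
... | g , refl =
  g , negˢ g ,
  trans (cong (λ t → total g + t) (total-negˢ g)) (ℤP.+-inverseʳ (total g)) ,
  trans (cong (λ t → total g - t) (total-negˢ g)) (double (total g)) ,
  trans (cong (signedSum g +ᵥ_) (signedSum-negˢ g)) (+ᵥ-inverseʳ (signedSum g))
  where double : ∀ t → t - - t ≡ + 2 * t
        double = solve-∀

module _ {A : Set} {x : A} where

  insertˢ : (ys : List A) {zs : List A} → Bool → Signing (ys ++ zs) → Signing (ys ++ x ∷ zs)
  insertˢ [] c ε = c ∷ ε
  insertˢ (_ ∷ ys) c (b ∷ ε) = b ∷ insertˢ ys c ε

  total-insertˢ : (ys : List A) {zs : List A} (c : Bool) (ε : Signing (ys ++ zs)) →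
                  total (insertˢ ys c ε) ≡ sgn c + total ε
  total-insertˢ [] c ε = refl
  total-insertˢ (_ ∷ ys) c (b ∷ ε) =
    trans (cong (λ t → sgn b + t) (total-insertˢ ys c ε)) (leftComm (sgn b) (sgn c) (total ε))
    where leftComm : ∀ b c t → b + (c + t) ≡ c + (b + t)
          leftComm = solve-∀

  length-insert : (ys : List A) {zs : List A} → length (ys ++ x ∷ zs) ≡ suc (length (ys ++ zs))
  length-insert [] = refl
  length-insert (_ ∷ ys) = cong suc (length-insert ys)

  parity-insert : (ys : List A) {zs : List A} → parity (length (ys ++ x ∷ zs)) ⁻¹ ≡ parity (length (ys ++ zs))
  parity-insert ys {zs} = trans (cong (λ n → parity n ⁻¹) (length-insert ys)) (ℙP.suc-homo-⁻¹ (length (ys ++ zs)))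

signedSum-insertˢ : ∀ {a} {x : Vec ℤ a} (ys : List (Vec ℤ a)) {zs} (c : Bool) (ε : Signing (ys ++ zs)) →
                    signedSum (insertˢ {x = x} ys c ε) ≡ (sgn c ·ᵥ x) +ᵥ signedSum ε
signedSum-insertˢ [] c ε = refl
signedSum-insertˢ (y ∷ ys) c (b ∷ ε) =
  trans (cong ((sgn b ·ᵥ y) +ᵥ_) (signedSum-insertˢ ys c ε)) (+ᵥ-leftComm _ _ _)

pinned-pair : ∀ {a} (xs : List (Vec ℤ a)) {x} → x ∈ xs → (c : Bool) → ∀ {τ} →
              MinTotal (parity (length xs) ⁻¹) τ → MiddlePair xs (+ 2 * sgn c) τ ((+ 2 * sgn c) ·ᵥ x)
pinned-pair _ {x} x∈xs c τ-ok with ∈-∃++ x∈xs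
... | ys , zs , refl with signing-with-total (ys ++ zs) (subst (λ b → MinTotal b _) (parity-insert ys) τ-ok)
... | h , refl = insertˢ ys c h , insertˢ ys c (negˢ h) ,
  trans (cong₂ _+_ (total-insertˢ ys c h) total-neg) (sum (sgn c) (total h)) ,
  trans (cong₂ _-_ (total-insertˢ ys c h) total-neg) (difference (sgn c) (total h)) ,
  trans (cong₂ _+ᵥ_ (signedSum-insertˢ ys c h) signedSum-neg) (pin-sum (sgn c) x (signedSum h))
  where
  total-neg : total (insertˢ ys c (negˢ h)) ≡ sgn c + - total h
  total-neg = trans (total-insertˢ ys c (negˢ h)) (cong (λ t → sgn c + t) (total-negˢ h))
  signedSum-neg : signedSum (insertˢ ys c (negˢ h)) ≡ (sgn c ·ᵥ x) +ᵥ negᵥ (signedSum h)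
  signedSum-neg = trans (signedSum-insertˢ ys c (negˢ h)) (cong ((sgn c ·ᵥ x) +ᵥ_) (signedSum-negˢ h))
  sum : ∀ c t → (c + t) + (c + - t) ≡ + 2 * c
  sum = solve-∀
  difference : ∀ c t → (c + t) - (c + - t) ≡ + 2 * t
  difference = solve-∀
  pin-sum : ∀ {n} c (x S : Vec ℤ n) → ((c ·ᵥ x) +ᵥ S) +ᵥ ((c ·ᵥ x) +ᵥ negᵥ S) ≡ (+ 2 * c) ·ᵥ x
  pin-sum c [] [] = refl
  pin-sum c (x ∷ xs) (s ∷ ss) = cong₂ _∷_ (identity c x s) (pin-sum c xs ss)
    where identity : ∀ c x s → (c * x + s) + (c * x + - s) ≡ + 2 * c * x
          identity = solve-∀

-- Doubling

dup : ∀ {p} → Vec ℤ p → Vec ℤ (twice p)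
dup [] = []
dup (x ∷ u) = x ∷ x ∷ dup u

antidup : ∀ {p} → Vec ℤ p → Vec ℤ (twice p)
antidup [] = []
antidup (x ∷ u) = + 2 * x ∷ - (+ 2 * x) ∷ antidup u

dup-+ᵥ : ∀ {p} (u v : Vec ℤ p) → dup (u +ᵥ v) ≡ dup u +ᵥ dup v
dup-+ᵥ [] [] = refl
dup-+ᵥ (x ∷ u) (y ∷ v) = cong (λ w → x + y ∷ x + y ∷ w) (dup-+ᵥ u v)

antidup-+ᵥ : ∀ {p} (u v : Vec ℤ p) → antidup (u +ᵥ v) ≡ antidup u +ᵥ antidup v
antidup-+ᵥ [] [] = refl
antidup-+ᵥ (x ∷ u) (y ∷ v) = cong₂ _∷_ (ℤP.*-distribˡ-+ (+ 2) x y)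
  (cong₂ _∷_ (trans (cong -_ (ℤP.*-distribˡ-+ (+ 2) x y)) (ℤP.neg-distrib-+ (+ 2 * x) (+ 2 * y))) (antidup-+ᵥ u v))

dup-·ᵥ : ∀ {p} c (u : Vec ℤ p) → dup (c ·ᵥ u) ≡ c ·ᵥ dup u
dup-·ᵥ c [] = refl
dup-·ᵥ c (x ∷ u) = cong (λ w → c * x ∷ c * x ∷ w) (dup-·ᵥ c u)

dup-0ᵥ : ∀ {p} → dup (0ᵥ {p}) ≡ 0ᵥ
dup-0ᵥ {zero} = refl
dup-0ᵥ {suc p} = cong (λ w → 0ℤ ∷ 0ℤ ∷ w) dup-0ᵥ

antidup-0ᵥ : ∀ {p} → antidup (0ᵥ {p}) ≡ 0ᵥ
antidup-0ᵥ {zero} = refl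
antidup-0ᵥ {suc p} = cong (λ w → 0ℤ ∷ 0ℤ ∷ w) antidup-0ᵥ

All-dup : ∀ {p} {u : Vec ℤ p} → All IsSign u → All IsSign (dup u)
All-dup [] = []
All-dup (s ∷ signs) = s ∷ s ∷ All-dup signs

coordSum-dup : ∀ {p} (u : Vec ℤ p) → coordSum (dup u) ≡ coordSum u + coordSum u
coordSum-dup [] = refl
coordSum-dup (x ∷ u) = trans (cong (λ c → x + (x + c)) (coordSum-dup u)) (regroup x (coordSum u))
  where regroup : ∀ x c → x + (x + (c + c)) ≡ (x + c) + (x + c)
        regroup = solve-∀

dup-∈-layer : ∀ {p t} {u : Vec ℤ p} → All IsSign u → coordSum u ≡ t → dup u ∈ layer (twice p) (t + t)
dup-∈-layer {u = u} signs refl =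
  subst (λ s → dup u ∈ layer _ s) (coordSum-dup u) (∈-layer (dup u) (All-dup signs))

Pin : ℕ → ℤ → Set
Pin p t = Maybe (Bool × Σ (Vec ℤ p) λ u → All IsSign u × coordSum u ≡ t)

pinSign : ∀ {p t} → Pin p t → ℤ
pinSign nothing = 0ℤ
pinSign (just (c , _)) = sgn c

pinVec : ∀ {p t} → Pin p t → Vec ℤ p
pinVec nothing = 0ᵥ
pinVec (just (c , u , _)) = sgn c ·ᵥ u

pinned : ∀ {p t} → Pin p t → Parity
pinned nothing = 0ℙ
pinned (just _) = 1ℙ

-- The middle blocks of layer (2p+2) (2t) get opposite signs, except at a pinned x = dup u, where both get
-- the sign of the pin.
pin-pair : ∀ {p t} (e : Pin p t) {τ} → MinTotal (layerParity p t ℙ.+ pinned e) τ →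
           MiddlePair (layer (twice p) (t + t)) (+ 2 * pinSign e) τ (dup ((+ 2) ·ᵥ pinVec e))
pin-pair {p} {t} nothing τ-ok with opposite-pair (layer (twice p) (t + t))
  (subst (λ b → MinTotal b _) (trans (ℙP.+-identityʳ _) (sym (lucas p t))) τ-ok)
... | g , g′ , sum , diff , vec = g , g′ , sum , diff ,
  trans vec (sym (trans (cong dup (VP.map-replicate _ 0ℤ p)) dup-0ᵥ))
pin-pair {p} {t} (just (c , u , signs , sum-u)) τ-ok
  with pinned-pair (layer (twice p) (t + t)) (dup-∈-layer signs sum-u) c
         (subst (λ b → MinTotal b _) (trans (ℙP.+-comm _ 1ℙ) (cong _⁻¹ (sym (lucas p t)))) τ-ok)
... | g , g′ , sum , diff , vec = g , g′ , sum , diff ,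
  trans vec (sym (trans (cong dup (·ᵥ-assoc (+ 2) (sgn c) u)) (dup-·ᵥ (+ 2 * sgn c) u)))

data PinTree : ℕ → ℤ → Set where
  leaf : ∀ {t} → PinTree 0 t
  node : ∀ {p t} → Pin p t → PinTree p (t - 1ℤ) → PinTree p (t + 1ℤ) → PinTree (suc p) t

treeTotal : ∀ {p t} → PinTree p t → ℤ
treeTotal leaf = 0ℤ
treeTotal (node e l r) = + 2 * pinSign e + (treeTotal l + treeTotal r)

treeSum : ∀ {p t} → PinTree p t → Vec ℤ p
treeSum leaf = []
treeSum (node e l r) = (treeTotal l - treeTotal r) ∷ (((+ 2) ·ᵥ pinVec e) +ᵥ (treeSum l +ᵥ treeSum r))

slack : ∀ {p t} → PinTree p t → Vec Parity p
slack leaf = []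
slack (node {p} {t} e l r) = layerParity p t ℙ.+ pinned e ∷ zipWith ℙ._+_ (slack l) (slack r)

split-MinTotal : ∀ {n} (bs cs : Vec Parity n) {τ} → Pointwise MinTotal (zipWith ℙ._+_ bs cs) τ →
  Σ (Vec ℤ n) λ τ₁ → Σ (Vec ℤ n) λ τ₂ →
  Pointwise MinTotal bs τ₁ × Pointwise MinTotal cs τ₂ × τ ≡ τ₁ +ᵥ τ₂
split-MinTotal [] [] [] = [] , [] , [] , [] , refl
split-MinTotal (b ∷ bs) (c ∷ cs) (τ-ok ∷ τs-ok) with split₁ b c τ-ok | split-MinTotal bs cs τs-ok
  where
  split₁ : ∀ b c {τ} → MinTotal (b ℙ.+ c) τ →
           Σ ℤ λ x → Σ ℤ λ y → MinTotal b x × MinTotal c y × τ ≡ x + y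
  split₁ 0ℙ 0ℙ refl = 0ℤ , 0ℤ , refl , refl , refl
  split₁ 0ℙ 1ℙ τ-ok = 0ℤ , _ , refl , τ-ok , sym (ℤP.+-identityˡ _)
  split₁ 1ℙ 0ℙ τ-ok = _ , 0ℤ , τ-ok , refl , sym (ℤP.+-identityʳ _)
  split₁ 1ℙ 1ℙ refl = 1ℤ , - 1ℤ , inj₁ refl , inj₂ refl , refl
... | x , y , x-ok , y-ok , refl | τ₁ , τ₂ , τ₁-ok , τ₂-ok , refl =
  x ∷ τ₁ , y ∷ τ₂ , x-ok ∷ τ₁-ok , y-ok ∷ τ₂-ok , refl

doubling-sum : ∀ {p} (S₁ S₂ G₁ G₂ E τ₁ τ₂ : Vec ℤ p) (X Y : Vec ℤ (twice p)) → X +ᵥ Y ≡ dup E →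
  ((dup (S₁ +ᵥ G₁) +ᵥ antidup τ₁) +ᵥ X) +ᵥ (Y +ᵥ (dup (S₂ +ᵥ G₂) +ᵥ antidup τ₂))
  ≡ dup ((S₁ +ᵥ S₂) +ᵥ (E +ᵥ (G₁ +ᵥ G₂))) +ᵥ antidup (τ₁ +ᵥ τ₂)
doubling-sum S₁ S₂ G₁ G₂ E τ₁ τ₂ X Y X+Y≡dupE = begin
  ((dup (S₁ +ᵥ G₁) +ᵥ antidup τ₁) +ᵥ X) +ᵥ (Y +ᵥ (dup (S₂ +ᵥ G₂) +ᵥ antidup τ₂))
    ≡⟨ cong₂ (λ u v → ((u +ᵥ antidup τ₁) +ᵥ X) +ᵥ (Y +ᵥ (v +ᵥ antidup τ₂)))
             (dup-+ᵥ S₁ G₁) (dup-+ᵥ S₂ G₂) ⟩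
  (((dup S₁ +ᵥ dup G₁) +ᵥ antidup τ₁) +ᵥ X) +ᵥ (Y +ᵥ ((dup S₂ +ᵥ dup G₂) +ᵥ antidup τ₂))
    ≡⟨ regroup (dup S₁) (dup G₁) (antidup τ₁) X Y (dup S₂) (dup G₂) (antidup τ₂) (dup E) X+Y≡dupE ⟩
  ((dup S₁ +ᵥ dup S₂) +ᵥ (dup E +ᵥ (dup G₁ +ᵥ dup G₂))) +ᵥ (antidup τ₁ +ᵥ antidup τ₂)
    ≡⟨ cong₃ (sym (dup-+ᵥ S₁ S₂))
             (trans (cong (dup E +ᵥ_) (sym (dup-+ᵥ G₁ G₂))) (sym (dup-+ᵥ E (G₁ +ᵥ G₂))))
             (sym (antidup-+ᵥ τ₁ τ₂)) ⟩
  (dup (S₁ +ᵥ S₂) +ᵥ dup (E +ᵥ (G₁ +ᵥ G₂))) +ᵥ antidup (τ₁ +ᵥ τ₂)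
    ≡⟨ cong (_+ᵥ antidup (τ₁ +ᵥ τ₂)) (dup-+ᵥ (S₁ +ᵥ S₂) (E +ᵥ (G₁ +ᵥ G₂))) ⟨
  dup ((S₁ +ᵥ S₂) +ᵥ (E +ᵥ (G₁ +ᵥ G₂))) +ᵥ antidup (τ₁ +ᵥ τ₂) ∎
  where
  open ≡-Reasoning
  regroup : ∀ {n} (S₁ G₁ A₁ X Y S₂ G₂ A₂ E : Vec ℤ n) → X +ᵥ Y ≡ E →
    (((S₁ +ᵥ G₁) +ᵥ A₁) +ᵥ X) +ᵥ (Y +ᵥ ((S₂ +ᵥ G₂) +ᵥ A₂))
    ≡ ((S₁ +ᵥ S₂) +ᵥ (E +ᵥ (G₁ +ᵥ G₂))) +ᵥ (A₁ +ᵥ A₂)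
  regroup [] [] [] [] [] [] [] [] [] _ = refl
  regroup (s₁ ∷ S₁) (g₁ ∷ G₁) (a₁ ∷ A₁) (x ∷ X) (y ∷ Y) (s₂ ∷ S₂) (g₂ ∷ G₂) (a₂ ∷ A₂) (e ∷ E) eq =
    cong₂ _∷_ (trans (identity s₁ g₁ a₁ x y s₂ g₂ a₂)
                     (cong (λ z → s₁ + s₂ + (z + (g₁ + g₂)) + (a₁ + a₂)) (VP.∷-injectiveˡ eq)))
              (regroup S₁ G₁ A₁ X Y S₂ G₂ A₂ E (VP.∷-injectiveʳ eq))
    where identity : ∀ s₁ g₁ a₁ x y s₂ g₂ a₂ →
                     s₁ + g₁ + a₁ + x + (y + (s₂ + g₂ + a₂))
                     ≡ s₁ + s₂ + ((x + y) + (g₁ + g₂)) + (a₁ + a₂)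
          identity = solve-∀
  cong₃ : ∀ {u u′ v v′ w w′} → u ≡ u′ → v ≡ v′ → w ≡ w′ →
          (u +ᵥ v) +ᵥ w ≡ (u′ +ᵥ v′) +ᵥ w′
  cong₃ refl refl refl = refl

-- Each pin tree tr turns a signing of layer p t into one of layer (2p) (2t): u ↦ dup u keeps its sign, and the
-- middle blocks at depth i are signed by pin-pair, with surplus τᵢ ∈ {0, ±1} allowed by the parity slack.
doubling : ∀ {p t} (tr : PinTree p t) (ε : Signing (layer p t)) {τ} → Pointwise MinTotal (slack tr) τ →
  Signable (twice p) (t + t) (total ε + treeTotal tr) (dup (signedSum ε +ᵥ treeSum tr) +ᵥ antidup τ)
doubling {t = + zero}   leaf ε [] = signable ε (sym (ℤP.+-identityʳ _)) Vec₀-unique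
doubling {t = + suc _}  leaf ε [] = signable ε (sym (ℤP.+-identityʳ _)) Vec₀-unique
doubling {t = -[1+ _ ]} leaf ε [] = signable ε (sym (ℤP.+-identityʳ _)) Vec₀-unique
doubling {suc p} {t} (node e l r) ε {τ₀ ∷ _} (τ₀-ok ∷ τ-ok)
  with unconsˢ {p} {t} ε | split-MinTotal (slack l) (slack r) τ-ok | pin-pair e τ₀-ok
... | ε₁ , ε₂ , refl | τ₁ , τ₂ , τ₁-ok , τ₂-ok , refl | g , g′ , sum , diff , vec =
  subst₂ (Signable (twice (suc p)) (t + t)) totals sums
    (cons₂ left (signable g refl refl) (signable g′ refl refl) right)
  where
  down : ∀ t → (t - 1ℤ) + (t - 1ℤ) ≡ t + t - 1ℤ - 1ℤ
  down = solve-∀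
  up : ∀ t → (t + 1ℤ) + (t + 1ℤ) ≡ t + t + 1ℤ + 1ℤ
  up = solve-∀
  shuffle : ∀ t₁ T₁ x y t₂ T₂ →
            ((t₁ + T₁) + x) + (y + (t₂ + T₂)) ≡ (t₁ + t₂) + ((x + y) + (T₁ + T₂))
  shuffle = solve-∀
  head₁ : ∀ t₁ T₁ x y t₂ T₂ →
          ((t₁ + T₁) + x) - (y + (t₂ + T₂)) ≡ ((t₁ - t₂) + (T₁ - T₂)) + (x - y)
  head₁ = solve-∀
  head₂ : ∀ t₁ T₁ x y t₂ T₂ →
          ((t₁ + T₁) - x) + (y - (t₂ + T₂)) ≡ ((t₁ - t₂) + (T₁ - T₂)) + - (x - y)
  head₂ = solve-∀
  σ₁ : ℤ
  σ₁ = total ε₁ + treeTotal l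
  σ₂ : ℤ
  σ₂ = total ε₂ + treeTotal r
  F₁ : Vec ℤ (twice p)
  F₁ = dup (signedSum ε₁ +ᵥ treeSum l) +ᵥ antidup τ₁
  F₂ : Vec ℤ (twice p)
  F₂ = dup (signedSum ε₂ +ᵥ treeSum r) +ᵥ antidup τ₂
  h : ℤ
  h = (total ε₁ - total ε₂) + (treeTotal l - treeTotal r)
  left : Signable (twice p) (t + t - 1ℤ - 1ℤ) σ₁ F₁
  left = subst (λ s → Signable (twice p) s σ₁ F₁) (down t) (doubling l ε₁ τ₁-ok)
  right : Signable (twice p) (t + t + 1ℤ + 1ℤ) σ₂ F₂
  right = subst (λ s → Signable (twice p) s σ₂ F₂) (up t) (doubling r ε₂ τ₂-ok)
  totals : (σ₁ + total g) + (total g′ + σ₂) ≡ total (consˢ {p} {t} ε₁ ε₂) + treeTotal (node e l r)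
  totals = trans (shuffle (total ε₁) (treeTotal l) (total g) (total g′) (total ε₂) (treeTotal r))
                 (cong₂ (λ a b → a + (b + (treeTotal l + treeTotal r))) (sym (total-consˢ {p} {t} ε₁ ε₂)) sum)
  sums : ((σ₁ + total g) - (total g′ + σ₂)) ∷ ((σ₁ - total g) + (total g′ - σ₂))
           ∷ ((F₁ +ᵥ signedSum g) +ᵥ (signedSum g′ +ᵥ F₂))
         ≡ dup (signedSum (consˢ {p} {t} ε₁ ε₂) +ᵥ treeSum (node e l r)) +ᵥ antidup (τ₀ ∷ (τ₁ +ᵥ τ₂))
  sums = trans (cong₂ _∷_
    (trans (head₁ (total ε₁) (treeTotal l) (total g) (total g′) (total ε₂) (treeTotal r))
           (cong (λ d → h + d) diff))
    (cong₂ _∷_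
      (trans (head₂ (total ε₁) (treeTotal l) (total g) (total g′) (total ε₂) (treeTotal r))
             (cong (λ d → h + - d) diff))
      (doubling-sum (signedSum ε₁) (signedSum ε₂) (treeSum l) (treeSum r) ((+ 2) ·ᵥ pinVec e) τ₁ τ₂
                    (signedSum g) (signedSum g′) vec)))
    (cong (λ v → dup (v +ᵥ treeSum (node e l r)) +ᵥ antidup (τ₀ ∷ (τ₁ +ᵥ τ₂)))
          (sym (signedSum-consˢ {p} {t} ε₁ ε₂)))

pinCount : ∀ {p t} → PinTree p t → Vec Parity p
pinCount leaf = []
pinCount (node e l r) = pinned e ∷ zipWith ℙ._+_ (pinCount l) (pinCount r)

slack-pinCount : ∀ {p t} (tr : PinTree (suc p) t) → slack tr ≡ V.map (layerParity p t ℙ.+_) (pinCount tr)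
slack-pinCount (node {zero} e leaf leaf) = refl
slack-pinCount (node {suc p} {t} e l r) = cong (layerParity (suc p) t ℙ.+ pinned e ∷_) (begin
  zipWith ℙ._+_ (slack l) (slack r)
    ≡⟨ cong₂ (zipWith ℙ._+_) (slack-pinCount l) (slack-pinCount r) ⟩
  zipWith ℙ._+_ (V.map (layerParity p (t - 1ℤ) ℙ.+_) (pinCount l))
                (V.map (layerParity p (t + 1ℤ) ℙ.+_) (pinCount r))
    ≡⟨ zipWith-map-interchange {layerParity p (t - 1ℤ)} {layerParity p (t + 1ℤ)} (pinCount l) (pinCount r) ⟩
  V.map (layerParity p (t - 1ℤ) ℙ.+ layerParity p (t + 1ℤ) ℙ.+_) (zipWith ℙ._+_ (pinCount l) (pinCount r))
    ≡⟨ cong (λ b → V.map (b ℙ.+_) (zipWith ℙ._+_ (pinCount l) (pinCount r))) (layerParity-suc p t) ⟨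
  V.map (layerParity (suc p) t ℙ.+_) (zipWith ℙ._+_ (pinCount l) (pinCount r)) ∎)
  where
  open ≡-Reasoning
  zipWith-map-interchange : ∀ {a b n} (u v : Vec Parity n) →
    zipWith ℙ._+_ (V.map (a ℙ.+_) u) (V.map (b ℙ.+_) v) ≡ V.map (a ℙ.+ b ℙ.+_) (zipWith ℙ._+_ u v)
  zipWith-map-interchange [] [] = refl
  zipWith-map-interchange {a} {b} (x ∷ u) (y ∷ v) =
    cong₂ _∷_ (CSP.interchange a x b y) (zipWith-map-interchange {a} {b} u v)

unpinned : ∀ p t → PinTree p t
unpinned zero t = leaf
unpinned (suc p) t = node nothing (unpinned p (t - 1ℤ)) (unpinned p (t + 1ℤ))

treeTotal-unpinned : ∀ p t → treeTotal (unpinned p t) ≡ 0ℤ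
treeTotal-unpinned zero t = refl
treeTotal-unpinned (suc p) t
  rewrite treeTotal-unpinned p (t - 1ℤ) | treeTotal-unpinned p (t + 1ℤ) = refl

treeSum-unpinned : ∀ p t → treeSum (unpinned p t) ≡ 0ᵥ
treeSum-unpinned zero t = refl
treeSum-unpinned (suc p) t
  rewrite treeTotal-unpinned p (t - 1ℤ) | treeTotal-unpinned p (t + 1ℤ)
        | treeSum-unpinned p (t - 1ℤ) | treeSum-unpinned p (t + 1ℤ)
        | VP.map-replicate (+ 2 *_) 0ℤ p | +ᵥ-identityˡ (0ᵥ {p}) | +ᵥ-identityˡ (0ᵥ {p}) = refl

pinCount-unpinned : ∀ p t → pinCount (unpinned p t) ≡ replicate p 0ℙ
pinCount-unpinned zero t = refl
pinCount-unpinned (suc p) t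
  rewrite pinCount-unpinned p (t - 1ℤ) | pinCount-unpinned p (t + 1ℤ) =
  cong (0ℙ ∷_) (VP.zipWith-replicate ℙ._+_ 0ℙ 0ℙ)

MinTotal-0 : ∀ {n} → Pointwise MinTotal (replicate n 0ℙ) (0ᵥ {n})
MinTotal-0 {zero} = []
MinTotal-0 {suc n} = refl ∷ MinTotal-0 {n}

doubling-even : ∀ p t {σ G} → layerParity p t ≡ 0ℙ →
                Signable (suc p) t σ G → Signable (twice (suc p)) (t + t) σ (dup G)
doubling-even p t parity-0 (signable ε refl refl) =
  subst₂ (Signable (twice (suc p)) (t + t)) totals sums (doubling (unpinned (suc p) t) ε slack-ok)
  where
  slack-ok : Pointwise MinTotal (slack (unpinned (suc p) t)) (0ᵥ {suc p})
  slack-ok = subst (λ bs → Pointwise MinTotal bs (0ᵥ {suc p}))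
    (sym (begin
      slack (unpinned (suc p) t)
        ≡⟨ slack-pinCount (unpinned (suc p) t) ⟩
      V.map (layerParity p t ℙ.+_) (pinCount (unpinned (suc p) t))
        ≡⟨ cong (V.map _) (pinCount-unpinned (suc p) t) ⟩
      V.map (layerParity p t ℙ.+_) (replicate (suc p) 0ℙ)
        ≡⟨ VP.map-replicate _ 0ℙ (suc p) ⟩
      replicate (suc p) (layerParity p t ℙ.+ 0ℙ)
        ≡⟨ cong (replicate (suc p)) (trans (ℙP.+-identityʳ _) parity-0) ⟩
      replicate (suc p) 0ℙ ∎))
    (MinTotal-0 {suc p})
    where open ≡-Reasoning
  totals : total ε + treeTotal (unpinned (suc p) t) ≡ total ε
  totals = trans (cong (λ T → total ε + T) (treeTotal-unpinned (suc p) t)) (ℤP.+-identityʳ (total ε))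
  sums : dup (signedSum ε +ᵥ treeSum (unpinned (suc p) t)) +ᵥ antidup 0ᵥ ≡ dup (signedSum ε)
  sums rewrite treeSum-unpinned (suc p) t | +ᵥ-identityʳ (signedSum ε) | antidup-0ᵥ {suc p} =
    +ᵥ-identityʳ (dup (signedSum ε))

doubling-[] : ∀ {p t} (tr : PinTree p t) → layer p t ≡ [] → ∀ {τ} → Pointwise MinTotal (slack tr) τ →
              Signable (twice p) (t + t) (treeTotal tr) (dup (treeSum tr) +ᵥ antidup τ)
doubling-[] {p} {t} tr empty {τ} τ-ok with signable-[] p t empty
... | signable ε total≡0 sum≡0 = subst₂ (Signable (twice p) (t + t))
  (trans (cong (_+ treeTotal tr) total≡0) (ℤP.+-identityˡ _))
  (cong (λ S → dup S +ᵥ antidup τ) (trans (cong (_+ᵥ treeSum tr) sum≡0) (+ᵥ-identityˡ _)))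
  (doubling tr ε τ-ok)

pinValue : Maybe Bool → ℤ
pinValue nothing = 0ℤ
pinValue (just c) = sgn c

isPinned : Maybe Bool → Parity
isPinned nothing = 0ℙ
isPinned (just _) = 1ℙ

PinAllowed : ℤ → ℤ → Maybe Bool → Set
PinAllowed δ r nothing = ⊤
PinAllowed δ r (just _) = r ≡ δ

cancel-head : ∀ r x t δ → r + x ≡ t + δ → x ≡ t - r + δ
cancel-head r x t δ eq = trans (solve₁ r x) (trans (cong (_- r) eq) (solve₂ t δ r))
  where solve₁ : ∀ r x → x ≡ r + x - r
        solve₁ = solve-∀
        solve₂ : ∀ t δ r → t + δ - r ≡ t - r + δ
        solve₂ = solve-∀

pathPin : ∀ {p t δ r} (c : Maybe Bool) (ρ : Vec ℤ p) → All IsSign ρ → r + coordSum ρ ≡ t + δ →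
          PinAllowed δ r c → Pin p t
pathPin nothing _ _ _ _ = nothing
pathPin {t = t} {r = r} (just c) ρ signs sum refl =
  just (c , ρ , signs , trans (cancel-head r (coordSum ρ) t r sum) (solve t r))
  where solve : ∀ t r → t - r + r ≡ t
        solve = solve-∀

-- follows ρ from the root (left on 1, right on -1); at depth i it pins the rest of ρ with sign cs i, which
-- lies in the layer of that node exactly when ρᵢ = δ
pathTree : ∀ {p} t δ (ρ : Vec ℤ p) (cs : Vec (Maybe Bool) p) → All IsSign ρ → coordSum ρ ≡ t + δ →
           Pointwise (PinAllowed δ) ρ cs → PinTree p t
pathTree t δ [] [] [] _ [] = leaf
pathTree {suc p} t δ (_ ∷ ρ) (c ∷ cs) (inj₁ refl ∷ signs) sum (ok ∷ oks) =
  node (pathPin c ρ signs sum ok)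
       (pathTree (t - 1ℤ) δ ρ cs signs (cancel-head 1ℤ _ t δ sum) oks)
       (unpinned p (t + 1ℤ))
pathTree {suc p} t δ (_ ∷ ρ) (c ∷ cs) (inj₂ refl ∷ signs) sum (ok ∷ oks) =
  node (pathPin c ρ signs sum ok)
       (unpinned p (t - 1ℤ))
       (pathTree (t + 1ℤ) δ ρ cs signs (cancel-head (- 1ℤ) _ t δ sum) oks)

pinSign-pathPin : ∀ {p t δ r} c (ρ : Vec ℤ p) signs (sum : r + coordSum ρ ≡ t + δ) (ok : PinAllowed δ r c) →
                  pinSign (pathPin {t = t} c ρ signs sum ok) ≡ pinValue c
pinSign-pathPin nothing _ _ _ _ = refl
pinSign-pathPin (just _) _ _ _ refl = refl

pinVec-pathPin : ∀ {p t δ r} c (ρ : Vec ℤ p) signs (sum : r + coordSum ρ ≡ t + δ) (ok : PinAllowed δ r c) →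
                 pinVec (pathPin {t = t} c ρ signs sum ok) ≡ pinValue c ·ᵥ ρ
pinVec-pathPin nothing ρ _ _ _ = sym (VP.map-const ρ 0ℤ)
pinVec-pathPin (just _) _ _ _ refl = refl

pinned-pathPin : ∀ {p t δ r} c (ρ : Vec ℤ p) signs (sum : r + coordSum ρ ≡ t + δ) (ok : PinAllowed δ r c) →
                 pinned (pathPin {t = t} c ρ signs sum ok) ≡ isPinned c
pinned-pathPin nothing _ _ _ _ = refl
pinned-pathPin (just _) _ _ _ refl = refl

pinTotal : ∀ {p} → Vec (Maybe Bool) p → ℤ
pinTotal cs = coordSum (V.map pinValue cs)

pathSum : ∀ {p} → ℤ → Vec ℤ p → Vec (Maybe Bool) p → Vec ℤ p
pathSum S = zipWith (λ r c → + 2 * r * (S - pinValue c))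

treeTotal-pathTree : ∀ {p} t δ (ρ : Vec ℤ p) cs signs sum oks →
                     treeTotal (pathTree t δ ρ cs signs sum oks) ≡ + 2 * pinTotal cs
treeTotal-pathTree t δ [] [] [] _ [] = refl
treeTotal-pathTree {suc p} t δ (_ ∷ ρ) (c ∷ cs) (inj₁ refl ∷ signs) sum (ok ∷ oks) =
  trans (cong₂ (λ x y → + 2 * x + y) (pinSign-pathPin {t = t} c ρ signs sum ok)
                (cong₂ _+_ (treeTotal-pathTree (t - 1ℤ) δ ρ cs signs _ oks) (treeTotal-unpinned p (t + 1ℤ))))
        (distrib (pinValue c) (pinTotal cs))
  where distrib : ∀ x y → + 2 * x + (+ 2 * y + 0ℤ) ≡ + 2 * (x + y)
        distrib = solve-∀
treeTotal-pathTree {suc p} t δ (_ ∷ ρ) (c ∷ cs) (inj₂ refl ∷ signs) sum (ok ∷ oks) =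
  trans (cong₂ (λ x y → + 2 * x + y) (pinSign-pathPin {t = t} c ρ signs sum ok)
                (cong₂ _+_ (treeTotal-unpinned p (t - 1ℤ)) (treeTotal-pathTree (t + 1ℤ) δ ρ cs signs _ oks)))
        (distrib (pinValue c) (pinTotal cs))
  where distrib : ∀ x y → + 2 * x + (0ℤ + + 2 * y) ≡ + 2 * (x + y)
        distrib = solve-∀

pathSum-pin : ∀ {n} c S (ρ : Vec ℤ n) cs → ((+ 2) ·ᵥ (c ·ᵥ ρ)) +ᵥ pathSum S ρ cs ≡ pathSum (c + S) ρ cs
pathSum-pin c S [] [] = refl
pathSum-pin c S (r ∷ ρ) (d ∷ cs) = cong₂ _∷_ (identity c S r (pinValue d)) (pathSum-pin c S ρ cs)
  where identity : ∀ c S r d → + 2 * (c * r) + + 2 * r * (S - d) ≡ + 2 * r * (c + S - d)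
        identity = solve-∀

treeSum-pathTree : ∀ {p} t δ (ρ : Vec ℤ p) cs signs sum oks →
                   treeSum (pathTree t δ ρ cs signs sum oks) ≡ pathSum (pinTotal cs) ρ cs
treeSum-pathTree t δ [] [] [] _ [] = refl
treeSum-pathTree {suc p} t δ (_ ∷ ρ) (c ∷ cs) (inj₁ refl ∷ signs) sum (ok ∷ oks) = cong₂ _∷_
  (trans (cong₂ _-_ (treeTotal-pathTree (t - 1ℤ) δ ρ cs signs _ oks) (treeTotal-unpinned p (t + 1ℤ)))
         (identity (pinValue c) (pinTotal cs)))
  (trans (cong₂ (λ u v → ((+ 2) ·ᵥ u) +ᵥ v) (pinVec-pathPin {t = t} c ρ signs sum ok)
                (trans (cong₂ _+ᵥ_ (treeSum-pathTree (t - 1ℤ) δ ρ cs signs _ oks) (treeSum-unpinned p (t + 1ℤ)))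
                       (+ᵥ-identityʳ _)))
         (pathSum-pin (pinValue c) (pinTotal cs) ρ cs))
  where identity : ∀ x y → + 2 * y - 0ℤ ≡ + 2 * 1ℤ * (x + y - x)
        identity = solve-∀
treeSum-pathTree {suc p} t δ (_ ∷ ρ) (c ∷ cs) (inj₂ refl ∷ signs) sum (ok ∷ oks) = cong₂ _∷_
  (trans (cong₂ _-_ (treeTotal-unpinned p (t - 1ℤ)) (treeTotal-pathTree (t + 1ℤ) δ ρ cs signs _ oks))
         (identity (pinValue c) (pinTotal cs)))
  (trans (cong₂ (λ u v → ((+ 2) ·ᵥ u) +ᵥ v) (pinVec-pathPin {t = t} c ρ signs sum ok)
                (trans (cong₂ _+ᵥ_ (treeSum-unpinned p (t - 1ℤ)) (treeSum-pathTree (t + 1ℤ) δ ρ cs signs _ oks))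
                       (+ᵥ-identityˡ _)))
         (pathSum-pin (pinValue c) (pinTotal cs) ρ cs))
  where identity : ∀ x y → 0ℤ - + 2 * y ≡ + 2 * - 1ℤ * (x + y - x)
        identity = solve-∀

pinCount-pathTree : ∀ {p} t δ (ρ : Vec ℤ p) cs signs sum oks →
                    pinCount (pathTree t δ ρ cs signs sum oks) ≡ V.map isPinned cs
pinCount-pathTree t δ [] [] [] _ [] = refl
pinCount-pathTree {suc p} t δ (_ ∷ ρ) (c ∷ cs) (inj₁ refl ∷ signs) sum (ok ∷ oks) =
  cong₂ _∷_ (pinned-pathPin {t = t} c ρ signs sum ok)
    (trans (cong₂ (zipWith ℙ._+_) (pinCount-pathTree (t - 1ℤ) δ ρ cs signs _ oks) (pinCount-unpinned p (t + 1ℤ)))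
           (Pointwise-≡⇒≡ (zipWith-identityʳ ℙP.+-identityʳ (V.map isPinned cs))))
pinCount-pathTree {suc p} t δ (_ ∷ ρ) (c ∷ cs) (inj₂ refl ∷ signs) sum (ok ∷ oks) =
  cong₂ _∷_ (pinned-pathPin {t = t} c ρ signs sum ok)
    (trans (cong₂ (zipWith ℙ._+_) (pinCount-unpinned p (t - 1ℤ)) (pinCount-pathTree (t + 1ℤ) δ ρ cs signs _ oks))
           (Pointwise-≡⇒≡ (zipWith-identityˡ ℙP.+-identityˡ (V.map isPinned cs))))

per4 : ∀ {A : Set} → A → A → A → A → (n : ℕ) → Vec A n
per4 a b c d zero = []
per4 a b c d (suc n) = a ∷ per4 b c d a n

map-per4 : ∀ {A B : Set} (f : A → B) (a b c d : A) n → V.map f (per4 a b c d n) ≡ per4 (f a) (f b) (f c) (f d) n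
map-per4 f a b c d zero = refl
map-per4 f a b c d (suc n) = cong (f a ∷_) (map-per4 f b c d a n)

zipWith-per4 : ∀ {A B C : Set} (f : A → B → C) (a b c d : A) (a′ b′ c′ d′ : B) n →
  zipWith f (per4 a b c d n) (per4 a′ b′ c′ d′ n) ≡ per4 (f a a′) (f b b′) (f c c′) (f d d′) n
zipWith-per4 f a b c d a′ b′ c′ d′ zero = refl
zipWith-per4 f a b c d a′ b′ c′ d′ (suc n) = cong (f a a′ ∷_) (zipWith-per4 f b c d a b′ c′ d′ a′ n)

per4-replicate : ∀ {A : Set} (a : A) n → per4 a a a a n ≡ replicate n a
per4-replicate a zero = refl
per4-replicate a (suc n) = cong (a ∷_) (per4-replicate a n)

All-per4 : ∀ {A : Set} {P : A → Set} {a b c d} n → P a → P b → P c → P d → All P (per4 a b c d n)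
All-per4 zero pa pb pc pd = []
All-per4 (suc n) pa pb pc pd = pa ∷ All-per4 n pb pc pd pa

Pointwise-per4 : ∀ {A B : Set} {R : A → B → Set} {a b c d x y z w} n →
  R a x → R b y → R c z → R d w → Pointwise R (per4 a b c d n) (per4 x y z w n)
Pointwise-per4 zero ra rb rc rd = []
Pointwise-per4 (suc n) ra rb rc rd = ra ∷ Pointwise-per4 n rb rc rd ra

coordSum-per4 : ∀ x (a b c d : ℤ) → a + (b + (c + d)) ≡ 0ℤ → coordSum (per4 a b c d (twice (twice x))) ≡ 0ℤ
coordSum-per4 zero a b c d _ = refl
coordSum-per4 (suc x) a b c d a+b+c+d≡0 =
  trans (cong (λ z → a + (b + (c + (d + z)))) (coordSum-per4 x a b c d a+b+c+d≡0))
        (trans (assoc a b c d) a+b+c+d≡0)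
  where assoc : ∀ a b c d → a + (b + (c + (d + 0ℤ))) ≡ a + (b + (c + d))
        assoc = solve-∀

dup-per4 : ∀ (a b x y : ℤ) n → dup (per4 a b a b n) +ᵥ antidup (per4 x y x y n)
           ≡ per4 (a + + 2 * x) (a + - (+ 2 * x)) (b + + 2 * y) (b + - (+ 2 * y)) (twice n)
dup-per4 a b x y zero = refl
dup-per4 a b x y (suc n) = cong (λ v → a + + 2 * x ∷ a + - (+ 2 * x) ∷ v) (dup-per4 b a y x n)

-- Signings for n = 2m

zero-signing : ∀ k r → Signable (twice (suc (predDyadic k (suc r)))) 0ℤ 0ℤ 0ᵥ
zero-signing zero r = subst (Signable _ 0ℤ 0ℤ) dup-0ᵥ
  (doubling-even (twice (suc r)) 0ℤ (layerParity-0 (suc (twice r)))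
                 (signable-[] (suc (twice (suc r))) 0ℤ (layer-empty-odd-dim (suc r))))
zero-signing (suc k) r = subst (Signable _ 0ℤ 0ℤ) dup-0ᵥ
  (doubling-even (suc (twice (predDyadic k (suc r)))) 0ℤ (layerParity-0 (twice (predDyadic k (suc r))))
                 (zero-signing k r))

module _ (e : ℕ) where
  private
    x : ℕ
    x = predDyadic e 0
    q : ℕ
    q = suc (twice x)
    a : ℕ
    a = suc (twice q)
    ρ : Vec ℤ a
    ρ = per4 (- 1ℤ) 1ℤ (- 1ℤ) 1ℤ a
    cs : Vec (Maybe Bool) a
    cs = per4 (just true) nothing (just false) nothing a
    ρ-signs : All IsSign ρ
    ρ-signs = All-per4 a (inj₂ refl) (inj₁ refl) (inj₂ refl) (inj₁ refl)
    ρ-sum : coordSum ρ ≡ 0ℤ + - 1ℤ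
    ρ-sum = cong (λ z → - 1ℤ + (1ℤ + (- 1ℤ + z))) (coordSum-per4 x 1ℤ (- 1ℤ) 1ℤ (- 1ℤ) refl)
    cs-ok : Pointwise (PinAllowed (- 1ℤ)) ρ cs
    cs-ok = Pointwise-per4 a refl tt refl tt
    pinTotal-cs : pinTotal cs ≡ 0ℤ
    pinTotal-cs = trans (cong coordSum (map-per4 pinValue (just true) nothing (just false) nothing a))
                        (cong (λ z → 1ℤ + (0ℤ + (- 1ℤ + z))) (coordSum-per4 x 0ℤ 1ℤ 0ℤ (- 1ℤ) refl))
    G₀ : Vec ℤ a
    G₀ = per4 (- 1ℤ) (- 1ℤ) (+ 3) (- 1ℤ) a
    G₁ : Vec ℤ a
    G₁ = per4 (+ 2) 0ℤ (- (+ 2)) 0ℤ a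

  pow2-tree : PinTree a 0ℤ
  pow2-tree = pathTree 0ℤ (- 1ℤ) ρ cs ρ-signs ρ-sum cs-ok

  treeTotal-pow2-tree : treeTotal pow2-tree ≡ 0ℤ
  treeTotal-pow2-tree =
    trans (treeTotal-pathTree 0ℤ (- 1ℤ) ρ cs ρ-signs ρ-sum cs-ok) (cong (λ T → + 2 * T) pinTotal-cs)

  treeSum-pow2-tree : treeSum pow2-tree ≡ G₁
  treeSum-pow2-tree = trans (treeSum-pathTree 0ℤ (- 1ℤ) ρ cs ρ-signs ρ-sum cs-ok)
    (trans (cong (λ S → pathSum S ρ cs) pinTotal-cs)
           (zipWith-per4 (λ r c → + 2 * r * (0ℤ - pinValue c)) (- 1ℤ) 1ℤ (- 1ℤ) 1ℤ
                         (just true) nothing (just false) nothing a))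

  slack-pow2-tree : slack pow2-tree ≡ per4 1ℙ 0ℙ 1ℙ 0ℙ a
  slack-pow2-tree = begin
    slack pow2-tree
      ≡⟨ slack-pinCount pow2-tree ⟩
    V.map (layerParity (twice q) 0ℤ ℙ.+_) (pinCount pow2-tree)
      ≡⟨ cong₂ (λ b v → V.map (b ℙ.+_) v) (trans (lucas q 0ℤ) (layerParity-[] q 0ℤ (layer-empty-odd-dim x)))
                                          (pinCount-pathTree 0ℤ (- 1ℤ) ρ cs ρ-signs ρ-sum cs-ok) ⟩
    V.map (0ℙ ℙ.+_) (V.map isPinned cs)
      ≡⟨ VP.map-id _ ⟩
    V.map isPinned cs
      ≡⟨ map-per4 isPinned (just true) nothing (just false) nothing a ⟩
    per4 1ℙ 0ℙ 1ℙ 0ℙ a ∎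
    where open ≡-Reasoning

  -- doubling the signing for 2^(e+2) and adding the pin tree along (-1, 1, -1, 1, …) gives the one for 2^(e+3)
  pow2-step : ∀ {s} → IsSign s → Signable a (- 1ℤ) (- 1ℤ) G₀ →
    Signable (suc (twice a)) (- 1ℤ) (- 1ℤ)
             ((- 1ℤ) ∷ per4 (1ℤ + + 2 * s) (1ℤ - + 2 * s) (- 1ℤ) (- 1ℤ) (twice a))
  pow2-step {s} s-sign R =
    subst₂ (Signable (suc (twice a)) (- 1ℤ)) (cong (λ T → - 1ℤ + T) treeTotal-pow2-tree) sums
           (cons {s = - 1ℤ} doubled along-path)
    where
    τ : Vec ℤ a
    τ = per4 s 0ℤ s 0ℤ a
    doubled : Signable (twice a) (- 1ℤ - 1ℤ) (- 1ℤ) (dup G₀)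
    doubled = doubling-even (twice q) (- 1ℤ) (layerParity-[] (twice q) (- 1ℤ) (layer-empty-odd-sum q)) R
    along-path : Signable (twice a) (- 1ℤ + 1ℤ) (treeTotal pow2-tree) (dup (treeSum pow2-tree) +ᵥ antidup τ)
    along-path = doubling-[] pow2-tree (layer-empty-odd-dim q)
      (subst (λ bs → Pointwise MinTotal bs τ) (sym slack-pow2-tree) (Pointwise-per4 a s-sign refl s-sign refl))
    sums : (- 1ℤ - treeTotal pow2-tree) ∷ (dup G₀ +ᵥ (dup (treeSum pow2-tree) +ᵥ antidup τ))
           ≡ (- 1ℤ) ∷ per4 (1ℤ + + 2 * s) (1ℤ - + 2 * s) (- 1ℤ) (- 1ℤ) (twice a)
    sums = cong₂ _∷_ (cong (λ T → - 1ℤ - T) treeTotal-pow2-tree) (begin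
      dup G₀ +ᵥ (dup (treeSum pow2-tree) +ᵥ antidup τ)
        ≡⟨ cong (λ S → dup G₀ +ᵥ (dup S +ᵥ antidup τ)) treeSum-pow2-tree ⟩
      dup G₀ +ᵥ (dup G₁ +ᵥ antidup τ)
        ≡⟨ +ᵥ-assoc (dup G₀) (dup G₁) (antidup τ) ⟨
      (dup G₀ +ᵥ dup G₁) +ᵥ antidup τ
        ≡⟨ cong (_+ᵥ antidup τ) (dup-+ᵥ G₀ G₁) ⟨
      dup (G₀ +ᵥ G₁) +ᵥ antidup τ
        ≡⟨ cong (λ v → dup v +ᵥ antidup τ) (zipWith-per4 _+_ (- 1ℤ) (- 1ℤ) (+ 3) (- 1ℤ) (+ 2) 0ℤ (- (+ 2)) 0ℤ a) ⟩
      dup (per4 1ℤ (- 1ℤ) 1ℤ (- 1ℤ) a) +ᵥ antidup τ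
        ≡⟨ dup-per4 1ℤ (- 1ℤ) s 0ℤ a ⟩
      per4 (1ℤ + + 2 * s) (1ℤ - + 2 * s) (- 1ℤ) (- 1ℤ) (twice a) ∎)
      where open ≡-Reasoning

pow2-signing : ∀ e {s} → IsSign s →
  Signable (suc (twice (predDyadic (suc e) 0))) (- 1ℤ) (- 1ℤ)
           ((- 1ℤ) ∷ per4 (1ℤ + + 2 * s) (1ℤ - + 2 * s) (- 1ℤ) (- 1ℤ) (twice (predDyadic (suc e) 0)))
pow2-signing zero (inj₁ refl) = signable (false ∷ true ∷ false ∷ []) refl refl
pow2-signing zero (inj₂ refl) = signable (false ∷ false ∷ true ∷ []) refl refl
pow2-signing (suc e) s-sign = pow2-step e s-sign (pow2-signing e (inj₂ refl))

module _ (e : ℕ) where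
  private
    x : ℕ
    x = predDyadic e 0
    q : ℕ
    q = suc (twice x)
    a : ℕ
    a = suc (twice q)
    ρ₀ : Vec ℤ a
    ρ₀ = per4 (- 1ℤ) (- 1ℤ) 1ℤ 1ℤ a
    ρ₁ : Vec ℤ a
    ρ₁ = per4 1ℤ 1ℤ (- 1ℤ) (- 1ℤ) a
    cs₀ : Vec (Maybe Bool) a
    cs₀ = per4 nothing nothing (just true) (just false) a
    cs₁ : Vec (Maybe Bool) a
    cs₁ = per4 (just false) (just true) nothing nothing a
    ρ₀-signs : All IsSign ρ₀
    ρ₀-signs = All-per4 a (inj₂ refl) (inj₂ refl) (inj₁ refl) (inj₁ refl)
    ρ₁-signs : All IsSign ρ₁
    ρ₁-signs = All-per4 a (inj₁ refl) (inj₁ refl) (inj₂ refl) (inj₂ refl)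
    ρ₀-sum : coordSum ρ₀ ≡ - 1ℤ
    ρ₀-sum = cong (λ z → - 1ℤ + (- 1ℤ + (1ℤ + z))) (coordSum-per4 x 1ℤ (- 1ℤ) (- 1ℤ) 1ℤ refl)
    ρ₁-sum : coordSum ρ₁ ≡ 1ℤ
    ρ₁-sum = cong (λ z → 1ℤ + (1ℤ + (- 1ℤ + z))) (coordSum-per4 x (- 1ℤ) 1ℤ 1ℤ (- 1ℤ) refl)
    cs₀-ok : Pointwise (PinAllowed 1ℤ) ρ₀ cs₀
    cs₀-ok = Pointwise-per4 a tt tt refl refl
    cs₁-ok : Pointwise (PinAllowed 1ℤ) ρ₁ cs₁
    cs₁-ok = Pointwise-per4 a refl refl tt tt
    pinTotal-cs₀ : pinTotal cs₀ ≡ 1ℤ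
    pinTotal-cs₀ = trans (cong coordSum (map-per4 pinValue nothing nothing (just true) (just false) a))
                         (cong (λ z → 0ℤ + (0ℤ + (1ℤ + z))) (coordSum-per4 x (- 1ℤ) 0ℤ 0ℤ 1ℤ refl))
    pinTotal-cs₁ : pinTotal cs₁ ≡ 0ℤ
    pinTotal-cs₁ = trans (cong coordSum (map-per4 pinValue (just false) (just true) nothing nothing a))
                         (cong (λ z → - 1ℤ + (1ℤ + (0ℤ + z))) (coordSum-per4 x 0ℤ (- 1ℤ) 1ℤ 0ℤ refl))
    left : PinTree a (- 1ℤ - 1ℤ)
    left = pathTree (- 1ℤ - 1ℤ) 1ℤ ρ₀ cs₀ ρ₀-signs ρ₀-sum cs₀-ok
    right : PinTree a (- 1ℤ + 1ℤ)
    right = pathTree (- 1ℤ + 1ℤ) 1ℤ ρ₁ cs₁ ρ₁-signs ρ₁-sum cs₁-ok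
    treeTotal-left : treeTotal left ≡ + 2
    treeTotal-left = trans (treeTotal-pathTree (- 1ℤ - 1ℤ) 1ℤ ρ₀ cs₀ ρ₀-signs ρ₀-sum cs₀-ok)
                           (cong (λ T → + 2 * T) pinTotal-cs₀)
    treeTotal-right : treeTotal right ≡ 0ℤ
    treeTotal-right = trans (treeTotal-pathTree (- 1ℤ + 1ℤ) 1ℤ ρ₁ cs₁ ρ₁-signs ρ₁-sum cs₁-ok)
                            (cong (λ T → + 2 * T) pinTotal-cs₁)
    G : Vec ℤ (suc a)
    G = per4 (+ 2) (+ 2) (- (+ 2)) (- (+ 2)) (suc a)
    F : Vec ℤ (suc a)
    F = per4 (- (+ 2)) (- (+ 2)) (+ 2) (+ 2) (suc a)

  -- pins ρ₀ at the root and follows ρ₀ and -ρ₀, so that every depth carries an odd number of pins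
  pow2+2-tree : PinTree (suc a) (- 1ℤ)
  pow2+2-tree = node (just (false , ρ₀ , ρ₀-signs , ρ₀-sum)) left right

  treeTotal-pow2+2-tree : treeTotal pow2+2-tree ≡ 0ℤ
  treeTotal-pow2+2-tree = cong₂ (λ L R → - (+ 2) + (L + R)) treeTotal-left treeTotal-right

  treeSum-pow2+2-tree : treeSum pow2+2-tree ≡ G
  treeSum-pow2+2-tree = cong₂ _∷_ (cong₂ _-_ treeTotal-left treeTotal-right) (begin
    ((+ 2) ·ᵥ ((- 1ℤ) ·ᵥ ρ₀)) +ᵥ (treeSum left +ᵥ treeSum right)
      ≡⟨ cong₂ _+ᵥ_ (trans (cong ((+ 2) ·ᵥ_) (map-per4 (- 1ℤ *_) (- 1ℤ) (- 1ℤ) 1ℤ 1ℤ a))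
                           (map-per4 (+ 2 *_) 1ℤ 1ℤ (- 1ℤ) (- 1ℤ) a))
                    (cong₂ _+ᵥ_ (trans (treeSum-pathTree (- 1ℤ - 1ℤ) 1ℤ ρ₀ cs₀ ρ₀-signs ρ₀-sum cs₀-ok)
                                       (cong (λ S → pathSum S ρ₀ cs₀) pinTotal-cs₀))
                                (trans (treeSum-pathTree (- 1ℤ + 1ℤ) 1ℤ ρ₁ cs₁ ρ₁-signs ρ₁-sum cs₁-ok)
                                       (cong (λ S → pathSum S ρ₁ cs₁) pinTotal-cs₁))) ⟩
    per4 (+ 2) (+ 2) (- (+ 2)) (- (+ 2)) a +ᵥ (pathSum 1ℤ ρ₀ cs₀ +ᵥ pathSum 0ℤ ρ₁ cs₁)
      ≡⟨ cong (per4 (+ 2) (+ 2) (- (+ 2)) (- (+ 2)) a +ᵥ_) (trans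
           (cong₂ _+ᵥ_ (zipWith-per4 (λ r c → + 2 * r * (1ℤ - pinValue c)) (- 1ℤ) (- 1ℤ) 1ℤ 1ℤ
                                     nothing nothing (just true) (just false) a)
                       (zipWith-per4 (λ r c → + 2 * r * (0ℤ - pinValue c)) 1ℤ 1ℤ (- 1ℤ) (- 1ℤ)
                                     (just false) (just true) nothing nothing a))
           (zipWith-per4 _+_ (- (+ 2)) (- (+ 2)) 0ℤ (+ 4) (+ 2) (- (+ 2)) 0ℤ 0ℤ a)) ⟩
    per4 (+ 2) (+ 2) (- (+ 2)) (- (+ 2)) a +ᵥ per4 0ℤ (- (+ 4)) 0ℤ (+ 4) a
      ≡⟨ zipWith-per4 _+_ (+ 2) (+ 2) (- (+ 2)) (- (+ 2)) 0ℤ (- (+ 4)) 0ℤ (+ 4) a ⟩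
    per4 (+ 2) (- (+ 2)) (- (+ 2)) (+ 2) a ∎)
    where open ≡-Reasoning

  slack-pow2+2-tree : slack pow2+2-tree ≡ replicate (suc a) 0ℙ
  slack-pow2+2-tree = begin
    slack pow2+2-tree
      ≡⟨ slack-pinCount pow2+2-tree ⟩
    V.map (layerParity a (- 1ℤ) ℙ.+_) (1ℙ ∷ zipWith ℙ._+_ (pinCount left) (pinCount right))
      ≡⟨ cong₂ (λ b v → V.map (b ℙ.+_) (1ℙ ∷ v)) (layerParity-pow2 (suc e)) (cong₂ (zipWith ℙ._+_)
               (trans (pinCount-pathTree (- 1ℤ - 1ℤ) 1ℤ ρ₀ cs₀ ρ₀-signs ρ₀-sum cs₀-ok)
                      (map-per4 isPinned nothing nothing (just true) (just false) a))
               (trans (pinCount-pathTree (- 1ℤ + 1ℤ) 1ℤ ρ₁ cs₁ ρ₁-signs ρ₁-sum cs₁-ok)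
                      (map-per4 isPinned (just false) (just true) nothing nothing a))) ⟩
    V.map (1ℙ ℙ.+_) (1ℙ ∷ zipWith ℙ._+_ (per4 0ℙ 0ℙ 1ℙ 1ℙ a) (per4 1ℙ 1ℙ 0ℙ 0ℙ a))
      ≡⟨ cong (λ v → V.map (1ℙ ℙ.+_) (1ℙ ∷ v))
              (trans (zipWith-per4 ℙ._+_ 0ℙ 0ℙ 1ℙ 1ℙ 1ℙ 1ℙ 0ℙ 0ℙ a) (per4-replicate 1ℙ a)) ⟩
    V.map (1ℙ ℙ.+_) (replicate (suc a) 1ℙ)
      ≡⟨ VP.map-replicate (1ℙ ℙ.+_) 1ℙ (suc a) ⟩
    replicate (suc a) 0ℙ ∎
    where open ≡-Reasoning

  -- n = 2^(e+3) + 2: layer (2a+3) (-1) splits into layer (2a+2) (-2), signed by the pin tree, and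
  -- layer (2a+2) 0, doubled from the two signings for 2^(e+2) (one of them reflected)
  pow2+2-signing : Signable (suc (twice (suc a))) (- 1ℤ) 0ℤ 0ᵥ
  pow2+2-signing = subst₂ (Signable (suc (twice (suc a))) (- 1ℤ))
    (trans (ℤP.+-identityʳ _) treeTotal-pow2+2-tree) sums (cons {s = - 1ℤ} pinned-doubled doubled)
    where
    halves : Signable (suc a) 0ℤ 0ℤ F
    halves = subst (Signable (suc a) 0ℤ 0ℤ)
      (cong ((- (+ 2)) ∷_) (trans (cong (per4 (- 1ℤ) (- 1ℤ) (+ 3) (- 1ℤ) a +ᵥ_)
                                        (negᵥ-involutive (per4 (- 1ℤ) (+ 3) (- 1ℤ) (- 1ℤ) a)))
                                  (zipWith-per4 _+_ (- 1ℤ) (- 1ℤ) (+ 3) (- 1ℤ) (- 1ℤ) (+ 3) (- 1ℤ) (- 1ℤ) a)))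
      (cons {s = 0ℤ} (pow2-signing e (inj₂ refl)) (reflect {s = - 1ℤ} (negate (pow2-signing e (inj₁ refl)))))
    doubled : Signable (twice (suc a)) (- 1ℤ + 1ℤ) 0ℤ (dup F)
    doubled = doubling-even a 0ℤ (layerParity-[] a 0ℤ (layer-empty-odd-dim q)) halves
    pinned-doubled : Signable (twice (suc a)) (- 1ℤ - 1ℤ) (treeTotal pow2+2-tree)
                              (dup (treeSum pow2+2-tree) +ᵥ antidup 0ᵥ)
    pinned-doubled = doubling-[] pow2+2-tree (layer-empty-odd-sum (suc q))
      (subst (λ bs → Pointwise MinTotal bs (0ᵥ {suc a})) (sym slack-pow2+2-tree) MinTotal-0)
    sums : (treeTotal pow2+2-tree - 0ℤ) ∷ ((dup (treeSum pow2+2-tree) +ᵥ antidup 0ᵥ) +ᵥ dup F) ≡ 0ᵥ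
    sums = cong₂ _∷_ (cong (_- 0ℤ) treeTotal-pow2+2-tree) (begin
      (dup (treeSum pow2+2-tree) +ᵥ antidup 0ᵥ) +ᵥ dup F
        ≡⟨ cong₂ (λ G′ A → (dup G′ +ᵥ A) +ᵥ dup F) treeSum-pow2+2-tree (antidup-0ᵥ {suc a}) ⟩
      (dup G +ᵥ 0ᵥ) +ᵥ dup F
        ≡⟨ cong (_+ᵥ dup F) (+ᵥ-identityʳ (dup G)) ⟩
      dup G +ᵥ dup F
        ≡⟨ dup-+ᵥ G F ⟨
      dup (G +ᵥ F)
        ≡⟨ cong dup (trans (zipWith-per4 _+_ (+ 2) (+ 2) (- (+ 2)) (- (+ 2)) (- (+ 2)) (- (+ 2)) (+ 2) (+ 2) (suc a))
                           (per4-replicate 0ℤ (suc a))) ⟩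
      dup 0ᵥ
        ≡⟨ dup-0ᵥ ⟩
      0ᵥ ∎)
      where open ≡-Reasoning

layerParity-twice-0 : ∀ k r → layerParity (twice (predDyadic k (suc r))) 0ℤ ≡ 0ℙ
layerParity-twice-0 zero r = trans (lucas (twice (suc r)) 0ℤ) (layerParity-0 (suc (twice r)))
layerParity-twice-0 (suc k) r =
  trans (lucas (predDyadic (suc k) (suc r)) 0ℤ) (layerParity-0 (twice (predDyadic k (suc r))))

-- layer (2p+3) (-1) = (1, layer (2p+2) (-2)) ∪ (-1, layer (2p+2) 0), both halves doubled from layer (p+1)
double-halves : ∀ p → layerParity p (- 1ℤ) ≡ 0ℙ → layerParity p 0ℤ ≡ 0ℙ →
  Signable (suc p) (- 1ℤ) 0ℤ 0ᵥ → Signable (suc p) 0ℤ 0ℤ 0ᵥ →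
  Signable (suc (twice (suc p))) (- 1ℤ) 0ℤ 0ᵥ
double-halves p odd-even even-even lower upper =
  subst (Signable _ (- 1ℤ) 0ℤ) (cong (0ℤ ∷_) (trans (cong₂ _+ᵥ_ dup-0ᵥ dup-0ᵥ) (+ᵥ-identityˡ 0ᵥ)))
    (cons {s = - 1ℤ} (doubling-even p (- 1ℤ) odd-even lower) (doubling-even p 0ℤ even-even upper))

not-pow2-signing : ∀ k r → Signable (suc (twice (predDyadic k (suc r)))) (- 1ℤ) 0ℤ 0ᵥ
not-pow2-signing zero r with predDyadic-surjective r
... | j , suc s , refl = double-halves (suc (twice r)) (layerParity-not-pow2 j s)
  (layerParity-[] (suc (twice r)) 0ℤ (layer-empty-odd-dim r))
  (signable-[] (twice (suc r)) (- 1ℤ) (layer-empty-odd-sum (suc r))) (zero-signing j s)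
... | zero , zero , refl = -- n = 6
  signable (true ∷ true ∷ false ∷ false ∷ false ∷ true ∷ false ∷ false ∷ true ∷ true ∷ []) refl refl
... | suc e , zero , refl = pow2+2-signing e
not-pow2-signing (suc k) r = double-halves (twice P)
  (layerParity-[] (twice P) (- 1ℤ) (layer-empty-odd-sum P)) (layerParity-twice-0 k r)
  (not-pow2-signing k r) (signable-[] (suc (twice P)) 0ℤ (layer-empty-odd-dim P))
  where P : ℕ
        P = predDyadic k (suc r)

-- suc (4 + m) % 4 reduces to suc m % 4, so wVec (4 + n) unfolds to 1 ∷ 1 ∷ 1 ∷ -3 ∷ wVec n
wVec-per4 : ∀ n → wVec n ≡ per4 1ℤ 1ℤ 1ℤ (- (+ 3)) n
wVec-per4 0 = refl
wVec-per4 1 = refl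
wVec-per4 2 = refl
wVec-per4 3 = refl
wVec-per4 (suc (suc (suc (suc n)))) = cong (λ v → 1ℤ ∷ 1ℤ ∷ 1ℤ ∷ - (+ 3) ∷ v) (wVec-per4 n)

+ᵥ-w : ∀ {n} (u : Vec ℤ n) → u +ᵥ per4 (- 1ℤ) (- 1ℤ) (- 1ℤ) (+ 3) n ≡ u -ᵥ wVec n
+ᵥ-w {n} u = begin
  u +ᵥ per4 (- 1ℤ) (- 1ℤ) (- 1ℤ) (+ 3) n    ≡⟨ cong (u +ᵥ_) (map-per4 -_ 1ℤ 1ℤ 1ℤ (- (+ 3)) n) ⟨
  u +ᵥ negᵥ (per4 1ℤ 1ℤ 1ℤ (- (+ 3)) n)     ≡⟨ cong (λ w → u +ᵥ negᵥ w) (wVec-per4 n) ⟨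
  u +ᵥ negᵥ (wVec n)                        ≡⟨ VP.zipWith-map₂ _+_ -_ u (wVec n) ⟩
  u -ᵥ wVec n                               ∎
  where open ≡-Reasoning

twice-suc-pow2 : ∀ m j → twice (suc m) ≡ 2 ^ j → ∃[ i ] suc m ≡ 2 ^ i
twice-suc-pow2 m zero ()
twice-suc-pow2 m (suc j) eq = j , ℕP.*-cancelˡ-≡ _ _ 2 (trans (sym (twice-≡-2* (suc m))) eq)

twice-suc-predDyadic-0 : ∀ k → twice (suc (predDyadic k 0)) ≡ 2 ^ suc k
twice-suc-predDyadic-0 k = trans (twice-≡-2* _) (cong (2 ℕ.*_) (suc-predDyadic-0 k))

SubsetSums : ℕ → Set
SubsetSums n = ((¬ (∃[ k ] n ≡ 2 ^ k)) →
                  ∃[ S ] (S ⊆ V0 n × ((+ 2) ·ᵥ vsum S) ≡ vsum (V0 n)))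
             × ((∃[ k ] n ≡ 2 ^ k) → n > 2 →
                  ∃[ S ] (S ⊆ V0 n × ((+ 2) ·ᵥ vsum S) ≡ (vsum (V0 n) -ᵥ wVec n)))

twice-predDyadic-not-pow2 : ∀ k r j → twice (suc (predDyadic k (suc r))) ≡ 2 ^ j → ⊥
twice-predDyadic-not-pow2 k r j n≡2^j with twice-suc-pow2 _ j n≡2^j
... | i , m≡2^i with suc-predDyadic-pow2 k (suc r) i m≡2^i
... | ()

subsetSum-not-pow2 : ∀ k r → let n = twice (suc (predDyadic k (suc r))) in
  ∃[ S ] (S ⊆ V0 n × (+ 2) ·ᵥ vsum S ≡ vsum (V0 n))
subsetSum-not-pow2 k r with subset-of-signing (not-pow2-signing k r)
... | S , S⊆V0 , sum = S , S⊆V0 , trans sum (+ᵥ-identityʳ _)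

subsetSum-pow2 : ∀ e → let n = twice (suc (predDyadic (suc e) 0)) in
  ∃[ S ] (S ⊆ V0 n × (+ 2) ·ᵥ vsum S ≡ vsum (V0 n) -ᵥ wVec n)
subsetSum-pow2 e with subset-of-signing (pow2-signing e (inj₂ refl))
... | S , S⊆V0 , sum = S , S⊆V0 , trans sum (+ᵥ-w _)

subsetSums-twice : ∀ h → SubsetSums (twice h)
subsetSums-twice zero = (λ _ → [] , [] , refl) , λ _ ()
subsetSums-twice (suc q) with predDyadic-surjective q
... | k , suc r , refl =
  (λ _ → subsetSum-not-pow2 k r) , λ { (j , n≡2^j) _ → ⊥-elim (twice-predDyadic-not-pow2 k r j n≡2^j) }
... | zero , zero , refl =
  (λ ¬pow2 → ⊥-elim (¬pow2 (1 , refl))) , λ _ 2>2 → ⊥-elim (ℕP.<-irrefl refl 2>2)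
... | suc e , zero , refl =
  (λ ¬pow2 → ⊥-elim (¬pow2 (suc (suc e) , twice-suc-predDyadic-0 (suc e)))) , λ _ _ → subsetSum-pow2 e

lemma5 : ∀ (n : ℕ) → 2 ∣ n →
           ((¬ (∃[ k ] n ≡ 2 ^ k)) →
              ∃[ S ] (S ⊆ V0 n × ((+ 2) ·ᵥ vsum S) ≡ vsum (V0 n)))
         × ((∃[ k ] n ≡ 2 ^ k) → n > 2 →
              ∃[ S ] (S ⊆ V0 n × ((+ 2) ·ᵥ vsum S) ≡ (vsum (V0 n) -ᵥ wVec n)))
lemma5 n (divides h n≡h*2) = subst SubsetSums (sym (trans n≡h*2 (trans (ℕP.*-comm h 2) (sym (twice-≡-2* h)))))
                                   (subsetSums-twice h)
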